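{- Let $n\ge 1$ and $k\ge 0$ be integers, let $G_n$ be the disjoint union of $n$ copies of the one-way infinite ladder, and let $M_n$ be the algebraic cycle matroid of $G_n$. Then $\mathrm{Spec}(M_n[k])=\{k,k+1,\dots,k+n\}$.
   Context: The one-way infinite ladder is the graph with vertex set $\mathbb N\times\{0,1\}$ and edges $(i,0)(i+1,0)$ (bottom edges), $(i,1)(i+1,1)$ (top edges) and $(i,0)(i,1)$ (middle edges) for $i\in\mathbb N$. For a graph $G$, an algebraic cycle is a non-empty set of edges $A$ such that every vertex has even degree in the graph $(V(G),A)$; the algebraic cycle matroid $M_{AC}(G)$ has ground set $E(G)$ and as independent sets the edge sets containing no algebraic cycle (for $G_n$ this is a matroid). A matroid is a pair $M=(E,\mathcal L)$ with $\mathcal L\subseteq 2^E$ satisfying (I1) $\emptyset\in\mathcal L$; (I2) closure under subsets; (I3) if $B$ is maximal in $\mathcal L$ and $A\in\mathcal L$ is not maximal, there is $b\in B\setminus A$ with $A\cup\{b\}\in\mathcal L$; (I4) if $A\in\mathcal L$ and $A\subseteq X\subseteq E$, $\{S\in\mathcal L:A\subseteq S\subseteq X\}$ has a maximal element. Maximal independent sets are bases. For $k\in\mathbb N$, $M[k]=(E,\mathcal L[k])$ where $\mathcal L[k]=\{S\in\mathcal L:\exists T\in\mathcal L,\ T\supseteq S,\ |T\setminus S|=k\}$. The finitarization of $(E,\mathcal L)$ is $(E,\mathcal L^{\mathrm{fin}})$ with $S\in\mathcal L^{\mathrm{fin}}$ iff all finite subsets of $S$ are in $\mathcal L$. The spectrum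 of $M$ is $\mathrm{Spec}(M)=\{|F\setminus B|: F\text{ a base of }M^{\mathrm{fin}},\ B\text{ a base of }M,\ B\subseteq F\}$, with all infinite cardinalities identified. -}

module Defs where

open import Data.Nat using (ℕ; zero; suc; _+_; _*_; _≤_)
open import Data.Fin using (Fin)
open import Data.Bool using (Bool; true; false)
open import Data.Product using (Σ; ∃; _×_; _,_)
open import Data.Sum using (_⊎_)
open import Relation.Nullary using (¬_)
open import Relation.Binary.PropositionalEquality using (_≡_)
open import Function.Bundles using (_↔_)

-- Subsets of a type, as Bool-valued characteristic functions
-- (under excluded middle every subset is of this form).

Subset : Set → Set
Subset E = E → Bool

_∈_ : {E : Set} → E → Subset E → Set
e ∈ S = S e ≡ true

_⊆_ : {E : Set} → Subset E → Subset E → Set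
_⊆_ {E} S T = (e : E) → e ∈ S → e ∈ T

Diff : {E : Set} → Subset E → Subset E → Set
Diff {E} S T = Σ E (λ e → (S e ≡ true) × (T e ≡ false))

Elems : {E : Set} → Subset E → Set
Elems {E} S = Σ E (λ e → S e ≡ true)

HasSize : Set → ℕ → Set
HasSize X m = X ↔ Fin m

Finite : Set → Set
Finite X = ∃ λ m → HasSize X m

-- cardinalities, with all infinite cardinalities identified
data Card : Set where
  fin : ℕ → Card
  inf : Card

CardIs : Set → Card → Set
CardIs X (fin m) = HasSize X m
CardIs X inf     = ¬ Finite X

Family : Set → Set₁
Family E = Subset E → Set

IsBase : {E : Set} → Family E → Subset E → Set
IsBase {E} ℒ B = ℒ B × ((S : Subset E) → ℒ S → B ⊆ S → S ⊆ B)

truncate : {E : Set} → Family E → ℕ → Family E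
truncate {E} ℒ k S = ℒ S × (Σ (Subset E) λ T → ℒ T × (S ⊆ T) × HasSize (Diff T S) k)

finitarization : {E : Set} → Family E → Family E
finitarization {E} ℒ S = (X : Subset E) → Finite (Elems X) → X ⊆ S → ℒ X

InSpec : {E : Set} → Family E → Card → Set
InSpec {E} ℒ c =
  Σ (Subset E) λ F → Σ (Subset E) λ B →
    IsBase (finitarization ℒ) F × IsBase ℒ B × (B ⊆ F) × CardIs (Diff F B) c

-- G_n : disjoint union of n one-way infinite ladders.
-- Vertices: (copy c, position i, level b) with b = false for 0, true for 1.

Vertex : ℕ → Set
Vertex n = Fin n × ℕ × Bool

data Edge (n : ℕ) : Set where
  bottom : Fin n → ℕ → Edge n
  top    : Fin n → ℕ → Edge n
  middle : Fin n → ℕ → Edge n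

end₁ : {n : ℕ} → Edge n → Vertex n
end₁ (bottom c i) = c , i , false
end₁ (top c i)    = c , i , true
end₁ (middle c i) = c , i , false

end₂ : {n : ℕ} → Edge n → Vertex n
end₂ (bottom c i) = c , suc i , false
end₂ (top c i)    = c , suc i , true
end₂ (middle c i) = c , i , true

Incident : {n : ℕ} → Edge n → Vertex n → Set
Incident e v = (end₁ e ≡ v) ⊎ (end₂ e ≡ v)

EvenDegree : {n : ℕ} → Subset (Edge n) → Vertex n → Set
EvenDegree {n} A v =
  ∃ λ m → HasSize (Σ (Edge n) λ e → (A e ≡ true) × Incident e v) (2 * m)

AlgebraicCycle : {n : ℕ} → Subset (Edge n) → Set
AlgebraicCycle {n} A = (∃ λ (e : Edge n) → e ∈ A) × ((v : Vertex n) → EvenDegree A v)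

AC-Independent : (n : ℕ) → Family (Edge n)
AC-Independent n S = ¬ (Σ (Subset (Edge n)) λ A → AlgebraicCycle A × A ⊆ S)

module Submission where

-- An edge set is AC-independent iff it contains no rectangle (two rungs joined
-- by both rails) and no infinite U (a rung followed by both full rails); the
-- converse direction is a parity argument copy by copy.  Consequently the
-- finitarization of M_n[k] consists of the rectangle-free sets.  For such a set
-- the "weight" of a copy at N (edges below N, the rung at N, one, and one more
-- if N is not linked) is at most 2N + 2, with equality for saturated sets, to
-- which no rail edge can be added.  Maximality makes a base F of the
-- finitarization and the witness T ⊇ B of a base B ⊆ F of M_n[k] saturated;
-- comparing the two equalities far out gives |F ∖ B| = |T ∖ B| + j = k + j,
-- where j ≤ n counts copies linked in F but not in T.  Conversely an explicit
-- pair F ⊇ B realises each j ≤ n.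

open import Defs
open import Data.Nat using (ℕ; _+_; _≤_)
open import Data.Product using (∃; _×_)
open import Relation.Binary.PropositionalEquality using (_≡_)
open import Function.Bundles using (_⇔_)
open import Axiom.ExcludedMiddle using (ExcludedMiddle)
open import Level using (0ℓ)

open import Data.Nat as ℕ using (zero; suc; _<_; z≤n; s≤s; _∸_; _⊔_; _<ᵇ_; parity; _<?_)
open import Data.Nat.Properties
open import Data.Nat.Tactic.RingSolver using (solve-∀)
open import Data.Parity.Base using (0ℙ)
open import Data.Parity.Properties using (*-homo-*)
open import Data.Fin as Fin using (Fin; toℕ) renaming (zero to fz; suc to fs)
open import Data.Fin.Properties using (+↔⊎; toℕ-fromℕ<)
open import Data.Fin.Permutation using (↔⇒≡)
open import Data.Bool using (Bool; true; false; _∧_; _∨_; not; _xor_)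
open import Data.Bool.Properties
  using ( ∨-zeroʳ; ∨-identityʳ; ∧-zeroʳ; ∧-identityʳ; not-involutive; not-¬; ¬-not; T-≡
        ; xor-∧-commutativeRing)
  renaming (_≟_ to _≟ᵇ_)
open import Algebra.Bundles using (CommutativeRing; CommutativeMonoid)
open import Algebra.Properties.CommutativeSemigroup
  (CommutativeMonoid.commutativeSemigroup (CommutativeRing.+-commutativeMonoid xor-∧-commutativeRing))
  renaming (interchange to xor-interchange)
  using ()
open import Data.Product using (Σ; _,_; proj₁; proj₂)
open import Data.Sum using (_⊎_; inj₁; inj₂; [_,_]′)
open import Data.Sum.Function.Propositional using (_⊎-↔_)
open import Data.Empty using (⊥; ⊥-elim)
open import Relation.Nullary using (¬_; Dec; yes; no; does)
open import Relation.Nullary.Decidable using (dec-true; dec-false; map′; _×-dec_)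
open import Relation.Binary.PropositionalEquality
  using (refl; sym; trans; cong; cong₂; subst; module ≡-Reasoning)
open import Axiom.UniquenessOfIdentityProofs using (module Decidable⇒UIP)
open import Function.Bundles using (_↔_; mk↔ₛ′; Inverse; mk⇔; Equivalence)
open import Function.Properties.Inverse using (↔-sym; ↔-trans)
open import Algebra.Properties.CommutativeMonoid.Sum +-0-commutativeMonoid
  using (sum; ∑-distrib-+; sum-cong-≗)

clash : ∀ {x} → x ≡ true → x ≡ false → ⊥
clash = not-¬

¬true⇒false : ∀ {x} → ¬ (x ≡ true) → x ≡ false
¬true⇒false = ¬-not

¬false⇒true : ∀ {x} → ¬ (x ≡ false) → x ≡ true
¬false⇒true = ¬-not

∧-elim : ∀ {x y} → x ∧ y ≡ true → x ≡ true × y ≡ true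
∧-elim {true} {true} refl = refl , refl

∧-intro : ∀ {x y} → x ≡ true → y ≡ true → x ∧ y ≡ true
∧-intro refl refl = refl

∨-elim : ∀ {x y} → x ∨ y ≡ true → (x ≡ true) ⊎ (y ≡ true)
∨-elim {true} p = inj₁ refl
∨-elim {false} p = inj₂ p

∨-inl : ∀ {x} y → x ≡ true → x ∨ y ≡ true
∨-inl y refl = refl

∨-inr : ∀ x {y} → y ≡ true → x ∨ y ≡ true
∨-inr true p = refl
∨-inr false p = p

not-true : ∀ {x} → not x ≡ true → x ≡ false
not-true {false} refl = refl

bool-uip : ∀ {b c : Bool} (p q : b ≡ c) → p ≡ q
bool-uip = Decidable⇒UIP.≡-irrelevant _≟ᵇ_

eqFin : ∀ {n} → Fin n → Fin n → Bool
eqFin c' c = does (c' Fin.≟ c)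

eqFin-refl : ∀ {n} (c : Fin n) → eqFin c c ≡ true
eqFin-refl c = dec-true (c Fin.≟ c) refl

eqFin-sound : ∀ {n} {c' c : Fin n} → eqFin c' c ≡ true → c' ≡ c
eqFin-sound {c' = c'} {c} p with c' Fin.≟ c
... | yes q = q
eqFin-sound () | no _

𝟙 : Bool → ℕ
𝟙 true = 1
𝟙 false = 0

𝟙≤1 : ∀ x → 𝟙 x ≤ 1
𝟙≤1 true = ≤-refl
𝟙≤1 false = z≤n

𝟙-split : ∀ x y → (x ≡ true → y ≡ true) → 𝟙 y ≡ 𝟙 x + 𝟙 (y ∧ not x)
𝟙-split true true h = refl
𝟙-split true false h with h refl
... | ()
𝟙-split false y h = cong 𝟙 (sym (∧-identityʳ y))

sumBelow : (ℕ → ℕ) → ℕ → ℕ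
sumBelow f W = sum {W} (λ i → f (toℕ i))

sumBelow-cong : ∀ {f g : ℕ → ℕ} W → (∀ i → f i ≡ g i) → sumBelow f W ≡ sumBelow g W
sumBelow-cong W h = sum-cong-≗ {W} (λ i → h (toℕ i))

sumBelow-+ : ∀ (f g : ℕ → ℕ) W → sumBelow (λ i → f i + g i) W ≡ sumBelow f W + sumBelow g W
sumBelow-+ f g W = ∑-distrib-+ {W} (λ i → f (toℕ i)) (λ i → g (toℕ i))

sumBelow-snoc : (f : ℕ → ℕ) (W : ℕ) → sumBelow f (suc W) ≡ sumBelow f W + f W
sumBelow-snoc f zero = +-comm (f 0) 0
sumBelow-snoc f (suc W) rewrite sumBelow-snoc (λ i → f (suc i)) W = sym (+-assoc (f 0) _ _)

sumBelow-window : ∀ (f : ℕ → ℕ) W k → (∀ i → i < W → f i ≡ 0) → (∀ i → i < k → f (W + i) ≡ 1) →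
                  sumBelow f (W + k) ≡ k
sumBelow-window f zero zero h0 h1 = refl
sumBelow-window f zero (suc k) h0 h1 rewrite h1 0 (s≤s z≤n) =
  cong suc (sumBelow-window (λ i → f (suc i)) 0 k (λ _ ()) (λ i p → h1 (suc i) (s≤s p)))
sumBelow-window f (suc W) k h0 h1 rewrite h0 0 (s≤s z≤n) =
  sumBelow-window (λ i → f (suc i)) W k (λ i p → h0 (suc i) (s≤s p)) (λ i p → h1 i p)

sum-zero : ∀ {n} {f : Fin n → ℕ} → (∀ c → f c ≡ 0) → sum f ≡ 0
sum-zero {zero} h = refl
sum-zero {suc n} h rewrite h fz = sum-zero (λ c → h (fs c))

sum-mono : ∀ {n} {f g : Fin n → ℕ} → (∀ c → f c ≤ g c) → sum f ≤ sum g
sum-mono {zero} h = z≤n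
sum-mono {suc n} h = +-mono-≤ (h fz) (sum-mono (λ c → h (fs c)))

sum-≥ : ∀ {n} (f : Fin n → ℕ) c → f c ≤ sum f
sum-≥ f fz = m≤m+n _ _
sum-≥ f (fs c) = ≤-trans (sum-≥ (λ c → f (fs c)) c) (m≤n+m _ _)

sum-𝟙≤ : ∀ {n} (f : Fin n → Bool) → sum (λ c → 𝟙 (f c)) ≤ n
sum-𝟙≤ {zero} f = z≤n
sum-𝟙≤ {suc n} f = +-mono-≤ (𝟙≤1 (f fz)) (sum-𝟙≤ (λ c → f (fs c)))

sum-below : ∀ {n} j → j ≤ n → sum {n} (λ c → 𝟙 (toℕ c <ᵇ j)) ≡ j
sum-below {zero} zero _ = refl
sum-below {suc n} zero _ = sum-zero {suc n} (λ c → refl)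
sum-below {suc n} (suc j) (s≤s le) = cong suc (sum-below j le)

eventually-all : ∀ {m} (Q : Fin m → ℕ → Set) → (∀ i {L L'} → L ≤ L' → Q i L → Q i L') →
                 (∀ i → Σ ℕ (Q i)) → Σ ℕ λ L → ∀ i → Q i L
eventually-all {zero} Q mono h = 0 , λ ()
eventually-all {suc m} Q mono h with h fz | eventually-all (λ i → Q (fs i)) (λ i → mono (fs i)) (λ i → h (fs i))
... | L₀ , q₀ | L₁ , q₁ =
  L₀ ⊔ L₁ , λ { fz → mono fz (m≤m⊔n L₀ L₁) q₀ ; (fs i) → mono (fs i) (m≤n⊔m L₀ L₁) (q₁ i) }

size-unique : ∀ {X : Set} {a b} → HasSize X a → HasSize X b → a ≡ b
size-unique h1 h2 = ↔⇒≡ (↔-trans (↔-sym h1) h2)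

cardIs-fin : ∀ {X : Set} {m} c → CardIs X c → HasSize X m → c ≡ fin m
cardIs-fin (fin a) h size = cong fin (size-unique h size)
cardIs-fin {m = m} inf infinite size = ⊥-elim (infinite (m , size))

resize : ∀ {X : Set} {a b} → a ≡ b → HasSize X a → HasSize X b
resize refl h = h

size-+ : ∀ {X Y : Set} {a b} → HasSize X a → HasSize Y b → HasSize (X ⊎ Y) (a + b)
size-+ hX hY = ↔-trans (hX ⊎-↔ hY) (↔-sym +↔⊎)

size-bool : (b : Bool) → HasSize (b ≡ true) (𝟙 b)
size-bool true = mk↔ₛ′ (λ _ → fz) (λ _ → refl) (λ { fz → refl ; (fs ()) }) (λ { refl → refl })
size-bool false = mk↔ₛ′ (λ ()) (λ ()) (λ ()) (λ ())

size-empty : {A : Set} (P : A → Set) → (∀ a → P a → ⊥) → HasSize (Σ A P) 0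
size-empty P h = mk↔ₛ′ (λ { (a , p) → ⊥-elim (h a p) }) (λ ()) (λ ()) (λ { (a , p) → ⊥-elim (h a p) })

split-ℕ : (P : ℕ → Set) → Σ ℕ P ↔ (P 0 ⊎ Σ ℕ (λ i → P (suc i)))
split-ℕ P = mk↔ₛ′ to from (λ { (inj₁ p) → refl ; (inj₂ _) → refl })
                          (λ { (zero , _) → refl ; (suc _ , _) → refl })
  where
  to : Σ ℕ P → (P 0 ⊎ Σ ℕ (λ i → P (suc i)))
  to (zero , p) = inj₁ p
  to (suc i , p) = inj₂ (i , p)
  from : (P 0 ⊎ Σ ℕ (λ i → P (suc i))) → Σ ℕ P
  from (inj₁ p) = 0 , p
  from (inj₂ (i , p)) = suc i , p

split-Fin : ∀ {n} (Q : Fin (suc n) → Set) → Σ (Fin (suc n)) Q ↔ (Q fz ⊎ Σ (Fin n) (λ c → Q (fs c)))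
split-Fin {n} Q = mk↔ₛ′ to from (λ { (inj₁ p) → refl ; (inj₂ _) → refl })
                                (λ { (fz , _) → refl ; (fs _ , _) → refl })
  where
  to : Σ (Fin (suc n)) Q → (Q fz ⊎ Σ (Fin n) (λ c → Q (fs c)))
  to (fz , p) = inj₁ p
  to (fs i , p) = inj₂ (i , p)
  from : (Q fz ⊎ Σ (Fin n) (λ c → Q (fs c))) → Σ (Fin (suc n)) Q
  from (inj₁ p) = fz , p
  from (inj₂ (i , p)) = fs i , p

size-ℕ : (q : ℕ → Bool) (W : ℕ) → (∀ i → q i ≡ true → i < W) →
         HasSize (Σ ℕ (λ i → q i ≡ true)) (sumBelow (λ i → 𝟙 (q i)) W)
size-ℕ q zero h = size-empty _ (λ i p → n≮0 (h i p))
size-ℕ q (suc W) h = ↔-trans (split-ℕ (λ i → q i ≡ true))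
  (size-+ (size-bool (q 0)) (size-ℕ (λ i → q (suc i)) W (λ i p → ≤-pred (h (suc i) p))))

size-Fin : ∀ {n} (Q : Fin n → Set) (f : Fin n → ℕ) → (∀ c → HasSize (Q c) (f c)) →
           HasSize (Σ (Fin n) Q) (sum f)
size-Fin {zero} Q f h = size-empty Q (λ ())
size-Fin {suc n} Q f h = ↔-trans (split-Fin Q)
  (size-+ (h fz) (size-Fin (λ c → Q (fs c)) (λ c → f (fs c)) (λ c → h (fs c))))

Elems-cong : ∀ {E : Set} (p q : Subset E) → (∀ e → p e ≡ q e) → Elems p ↔ Elems q
Elems-cong {E} p q h = mk↔ₛ′ (λ { (e , x) → e , trans (sym (h e)) x }) (λ { (e , x) → e , trans (h e) x })
  (λ { (e , x) → cong (e ,_) (bool-uip _ _) }) (λ { (e , x) → cong (e ,_) (bool-uip _ _) })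

_∖_ : ∀ {E : Set} → Subset E → Subset E → Subset E
(T ∖ S) e = T e ∧ not (S e)

Diff↔∖ : ∀ {E : Set} (T S : Subset E) → Diff T S ↔ Elems (T ∖ S)
Diff↔∖ {E} T S = mk↔ₛ′ to from (λ { (e , r) → cong (e ,_) (bool-uip _ _) })
  (λ { (e , p , q) → cong (e ,_) (cong₂ _,_ (bool-uip _ _) (bool-uip _ _)) })
  where
  to : Diff T S → Elems (T ∖ S)
  to (e , p , q) = e , cong₂ (λ a b → a ∧ not b) p q
  from : Elems (T ∖ S) → Diff T S
  from (e , r) = e , proj₁ (∧-elim r) , not-true (proj₂ (∧-elim {T e} r))

module _ {n : ℕ} where
  pos : Edge n → ℕ
  pos (bottom c i) = i
  pos (top c i) = i
  pos (middle c i) = i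

  copy : Edge n → Fin n
  copy (bottom c _) = c
  copy (top c _) = c
  copy (middle c _) = c

  Below : Subset (Edge n) → ℕ → Set
  Below S W = ∀ e → S e ≡ true → pos e < W

  atPos : Subset (Edge n) → Fin n → ℕ → ℕ
  atPos S c i = 𝟙 (S (bottom c i)) + 𝟙 (S (top c i)) + 𝟙 (S (middle c i))

  edgesIn : Subset (Edge n) → Fin n → ℕ → ℕ
  edgesIn S c W = sumBelow (atPos S c) W

  edges : Subset (Edge n) → ℕ → ℕ
  edges S W = sum (λ c → edgesIn S c W)

  split-Edge : (P : Edge n → Set) →
    Σ (Edge n) P ↔
    Σ (Fin n) (λ c → Σ ℕ (λ i → P (bottom c i)) ⊎
                     (Σ ℕ (λ i → P (top c i)) ⊎ Σ ℕ (λ i → P (middle c i))))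
  split-Edge P = mk↔ₛ′ to from
    (λ { (c , inj₁ _) → refl ; (c , inj₂ (inj₁ _)) → refl ; (c , inj₂ (inj₂ _)) → refl })
    (λ { (bottom c i , p) → refl ; (top c i , p) → refl ; (middle c i , p) → refl })
    where
    to : Σ (Edge n) P → _
    to (bottom c i , p) = c , inj₁ (i , p)
    to (top c i , p) = c , inj₂ (inj₁ (i , p))
    to (middle c i , p) = c , inj₂ (inj₂ (i , p))
    from : _ → Σ (Edge n) P
    from (c , inj₁ (i , p)) = bottom c i , p
    from (c , inj₂ (inj₁ (i , p))) = top c i , p
    from (c , inj₂ (inj₂ (i , p))) = middle c i , p

  edgesIn-split : ∀ S c W → edgesIn S c W ≡
    sumBelow (λ i → 𝟙 (S (bottom c i))) W +
    (sumBelow (λ i → 𝟙 (S (top c i))) W + sumBelow (λ i → 𝟙 (S (middle c i))) W)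
  edgesIn-split S c W = begin
    edgesIn S c W                       ≡⟨ sumBelow-+ (λ i → b i + t i) m W ⟩
    sumBelow (λ i → b i + t i) W + Σm   ≡⟨ cong (_+ Σm) (sumBelow-+ b t W) ⟩
    sumBelow b W + sumBelow t W + Σm    ≡⟨ +-assoc (sumBelow b W) _ _ ⟩
    sumBelow b W + (sumBelow t W + Σm)  ∎
    where
    open ≡-Reasoning
    b t m : ℕ → ℕ
    b i = 𝟙 (S (bottom c i))
    t i = 𝟙 (S (top c i))
    m i = 𝟙 (S (middle c i))
    Σm = sumBelow m W

  size-edges : ∀ S W → Below S W → HasSize (Elems S) (edges S W)
  size-edges S W h = ↔-trans (split-Edge (λ e → S e ≡ true))
    (size-Fin _ (λ c → edgesIn S c W) (λ c → resize (sym (edgesIn-split S c W))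
      (size-+ (size-ℕ (λ i → S (bottom c i)) W (λ i q → h (bottom c i) q))
      (size-+ (size-ℕ (λ i → S (top c i)) W (λ i q → h (top c i) q))
              (size-ℕ (λ i → S (middle c i)) W (λ i q → h (middle c i) q))))))

  finite⇒below : ∀ S → Finite (Elems S) → Σ ℕ (Below S)
  finite⇒below S (m , h) = suc (maxPos m (Inverse.from h)) , λ e p →
      s≤s (subst (λ y → pos (proj₁ y) ≤ _) (Inverse.inverseʳ h refl)
                 (maxPos-≥ m (Inverse.from h) (Inverse.to h (e , p))))
    where
    maxPos : ∀ m → (Fin m → Elems S) → ℕ
    maxPos zero g = 0
    maxPos (suc m) g = pos (proj₁ (g fz)) ⊔ maxPos m (λ x → g (fs x))
    maxPos-≥ : ∀ m g x → pos (proj₁ (g x)) ≤ maxPos m g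
    maxPos-≥ (suc m) g fz = m≤m⊔n _ _
    maxPos-≥ (suc m) g (fs x) = ≤-trans (maxPos-≥ m (λ y → g (fs y)) x) (m≤n⊔m _ _)

  below⇒finite : ∀ S W → Below S W → Finite (Elems S)
  below⇒finite S W h = edges S W , size-edges S W h

  atPos-∖ : ∀ S S' → S ⊆ S' → ∀ c i → atPos S' c i ≡ atPos S c i + atPos (S' ∖ S) c i
  atPos-∖ S S' sub c i
    rewrite 𝟙-split (S (bottom c i)) (S' (bottom c i)) (sub _)
          | 𝟙-split (S (top c i)) (S' (top c i)) (sub _)
          | 𝟙-split (S (middle c i)) (S' (middle c i)) (sub _) =
    regroup (𝟙 (S (bottom c i))) (𝟙 (S (top c i))) (𝟙 (S (middle c i))) _ _ _
    where
    regroup : ∀ a b c d e f → a + d + (b + e) + (c + f) ≡ a + b + c + (d + e + f)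
    regroup = solve-∀

  edgesIn-∖ : ∀ S S' → S ⊆ S' → ∀ c W → edgesIn S' c W ≡ edgesIn S c W + edgesIn (S' ∖ S) c W
  edgesIn-∖ S S' sub c W =
    trans (sumBelow-cong W (atPos-∖ S S' sub c)) (sumBelow-+ (atPos S c) (atPos (S' ∖ S) c) W)

  edges-suc : ∀ S W → edges S (suc W) ≡ edges S W + sum (λ c → atPos S c W)
  edges-suc S W =
    trans (sum-cong-≗ {n} (λ c → sumBelow-snoc (atPos S c) W)) (∑-distrib-+ (λ c → edgesIn S c W) _)

  edges-mono : ∀ S {W W'} → W ≤ W' → edges S W ≤ edges S W'
  edges-mono S {W} le = subst (λ x → edges S W ≤ edges S x) (m+[n∸m]≡n le) (grow _)
    where
    grow : ∀ d → edges S W ≤ edges S (W + d)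
    grow zero rewrite +-identityʳ W = ≤-refl
    grow (suc d) rewrite +-suc W d | edges-suc S (W + d) = ≤-trans (grow d) (m≤m+n _ _)

  edges-point : ∀ S e → S e ≡ true → suc (edges S (pos e)) ≤ edges S (suc (pos e))
  edges-point S e p
    rewrite edges-suc S (pos e) | +-comm (edges S (pos e)) (sum (λ c → atPos S c (pos e))) =
    +-monoˡ-≤ (edges S (pos e)) (≤-trans (present e p) (sum-≥ (λ c → atPos S c (pos e)) (copy e)))
    where
    present : ∀ e → S e ≡ true → 1 ≤ atPos S (copy e) (pos e)
    present (bottom c i) p rewrite p = s≤s z≤n
    present (top c i) p rewrite p = ≤-trans (m≤n+m 1 (𝟙 (S (bottom c i)))) (m≤m+n _ (𝟙 (S (middle c i))))
    present (middle c i) p rewrite p = m≤n+m 1 _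

  bounded⇒below : ExcludedMiddle 0ℓ → ∀ D b → (∀ W → edges D W ≤ b) → Σ ℕ (Below D)
  bounded⇒below LEM D b h with LEM {Σ ℕ (Below D)}
  ... | yes below = below
  ... | no unbounded = let W , b<edges = exceed (suc b) in ⊥-elim (<-irrefl refl (≤-trans b<edges (h W)))
    where
    exceed : ∀ m → Σ ℕ λ W → m ≤ edges D W
    exceed zero = 0 , z≤n
    exceed (suc m) with exceed m
    ... | W , le with LEM {Σ (Edge n) λ e → D e ≡ true × W ≤ pos e}
    ... | yes (e , de , W≤) = suc (pos e) , ≤-trans (s≤s (≤-trans le (edges-mono D W≤))) (edges-point D e de)
    ... | no none = ⊥-elim (unbounded (W , λ e de → ≰⇒> (λ W≤ → none (e , de , W≤))))

-- Geometry of a ladder: links, rectangles and U's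

module _ {n : ℕ} where
  rail : Bool → Fin n → ℕ → Edge n
  rail false = bottom
  rail true = top

  rails : Subset (Edge n) → Fin n → ℕ → Bool
  rails S c l = S (bottom c l) ∧ S (top c l)

  -- the two vertices at position N of copy c are linked inside positions ≤ N:
  -- computed recursively, witnessed by `Link` below
  linked : Subset (Edge n) → Fin n → ℕ → Bool
  linked S c zero = S (middle c zero)
  linked S c (suc N) = S (middle c (suc N)) ∨ (linked S c N ∧ rails S c N)

  Link : Subset (Edge n) → Fin n → ℕ → Set
  Link S c N = Σ ℕ λ r → r ≤ N × S (middle c r) ≡ true × (∀ l → r ≤ l → l < N → rails S c l ≡ true)

  -- S contains a rectangle closed by the rung at N + 1 (a finite cycle)
  closes : Subset (Edge n) → Fin n → ℕ → Bool
  closes S c N = linked S c N ∧ rails S c N ∧ S (middle c (suc N))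

  InfiniteU : Subset (Edge n) → Fin n → ℕ → Set
  InfiniteU S c r = S (middle c r) ≡ true × (∀ l → r ≤ l → rails S c l ≡ true)

  RectangleFree : Subset (Edge n) → Set
  RectangleFree S = ∀ c N → closes S c N ≡ false

  UFree : Subset (Edge n) → Set
  UFree S = ∀ c r → ¬ InfiniteU S c r

  -- the combinatorial form of AC-independence (see independent⇒ and independent⇐)
  LadderIndependent : Subset (Edge n) → Set
  LadderIndependent S = RectangleFree S × UFree S

  linked⇒Link : ∀ S c N → linked S c N ≡ true → Link S c N
  linked⇒Link S c zero p = 0 , z≤n , p , λ l _ l<0 → ⊥-elim (n≮0 l<0)
  linked⇒Link S c (suc N) p with S (middle c (suc N)) in rung
  ... | true = suc N , ≤-refl , rung , λ l r≤l l<r → ⊥-elim (<-irrefl refl (<-≤-trans l<r r≤l))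
  ... | false with linked⇒Link S c N (proj₁ (∧-elim p))
  ... | r , r≤N , rung-r , rl = r , m≤n⇒m≤1+n r≤N , rung-r , extend
    where
    extend : ∀ l → r ≤ l → l < suc N → rails S c l ≡ true
    extend l r≤l l<N+1 with m≤n⇒m<n∨m≡n (≤-pred l<N+1)
    ... | inj₁ l<N = rl l r≤l l<N
    ... | inj₂ refl = proj₂ (∧-elim {linked S c N} p)

  Link⇒linked : ∀ S c N → Link S c N → linked S c N ≡ true
  Link⇒linked S c zero (zero , _ , rung , _) = rung
  Link⇒linked S c (suc N) (r , r≤ , rung , rl) with m≤n⇒m<n∨m≡n r≤
  ... | inj₂ refl = ∨-inl _ rung
  ... | inj₁ r<N+1 = ∨-inr (S (middle c (suc N)))
        (∧-intro (Link⇒linked S c N (r , ≤-pred r<N+1 , rung , λ l a b → rl l a (m≤n⇒m≤1+n b)))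
                 (rl N (≤-pred r<N+1) ≤-refl))

  rung⇒linked : ∀ S c N → S (middle c N) ≡ true → linked S c N ≡ true
  rung⇒linked S c zero p = p
  rung⇒linked S c (suc N) p = ∨-inl _ p

  -- the rails and rungs of S are rails and rungs of S'; links, rectangles
  -- and U's only depend on these
  record _≼_ (S S' : Subset (Edge n)) : Set where
    constructor skeleton
    field
      rails≼ : ∀ c l → rails S c l ≡ true → rails S' c l ≡ true
      rungs≼ : ∀ c i → S (middle c i) ≡ true → S' (middle c i) ≡ true
  open _≼_ public

  ⊆⇒≼ : ∀ {S S'} → S ⊆ S' → S ≼ S'
  ⊆⇒≼ sub = skeleton (λ c l p → ∧-intro (sub _ (proj₁ (∧-elim p))) (sub _ (proj₂ (∧-elim p))))
                     (λ c i → sub _)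

  linked-mono : ∀ {S S'} → S ≼ S' → ∀ c N → linked S c N ≡ true → linked S' c N ≡ true
  linked-mono {S} {S'} ≼' c N p with linked⇒Link S c N p
  ... | r , r≤ , rung , rl =
    Link⇒linked S' c N (r , r≤ , rungs≼ ≼' c r rung , λ l a b → rails≼ ≼' c l (rl l a b))

  closes-mono : ∀ {S S'} → S ≼ S' → ∀ c N → closes S c N ≡ true → closes S' c N ≡ true
  closes-mono {S} ≼' c N p with ∧-elim {linked S c N} p
  ... | lk , q with ∧-elim {rails S c N} q
  ... | rl , rung = ∧-intro (linked-mono ≼' c N lk) (∧-intro (rails≼ ≼' c N rl) (rungs≼ ≼' c _ rung))

  U-mono : ∀ {S S'} → S ≼ S' → ∀ c r → InfiniteU S c r → InfiniteU S' c r
  U-mono ≼' c r (rung , rl) = rungs≼ ≼' c r rung , λ l a → rails≼ ≼' c l (rl l a)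

  rectangleFree-anti : ∀ {S S'} → S ≼ S' → RectangleFree S' → RectangleFree S
  rectangleFree-anti {S} {S'} ≼' free c N =
    ¬true⇒false (λ p → clash (closes-mono {S} {S'} ≼' c N p) (free c N))

  uFree-anti : ∀ {S S'} → S ≼ S' → UFree S' → UFree S
  uFree-anti {S} {S'} ≼' free c r u = free c r (U-mono {S} {S'} ≼' c r u)

-- A vertex (c, i, level) meets the rail edge leaving it to the right, the rung
-- at i and (for i > 0) the rail edge arriving from the left.  `Star A v` lists
-- these edges of A, and `degree A v` is their number.

module _ {n : ℕ} where
  Star : Subset (Edge n) → Vertex n → Set
  Star A (c , zero , false) = (A (bottom c 0) ≡ true) ⊎ (A (middle c 0) ≡ true)
  Star A (c , suc i , false) =
    ((A (bottom c (suc i)) ≡ true) ⊎ (A (middle c (suc i)) ≡ true)) ⊎ (A (bottom c i) ≡ true)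
  Star A (c , zero , true) = (A (top c 0) ≡ true) ⊎ (A (middle c 0) ≡ true)
  Star A (c , suc i , true) =
    ((A (top c (suc i)) ≡ true) ⊎ (A (middle c (suc i)) ≡ true)) ⊎ (A (top c i) ≡ true)

  degree : Subset (Edge n) → Vertex n → ℕ
  degree A (c , zero , false) = 𝟙 (A (bottom c 0)) + 𝟙 (A (middle c 0))
  degree A (c , suc i , false) = 𝟙 (A (bottom c (suc i))) + 𝟙 (A (middle c (suc i))) + 𝟙 (A (bottom c i))
  degree A (c , zero , true) = 𝟙 (A (top c 0)) + 𝟙 (A (middle c 0))
  degree A (c , suc i , true) = 𝟙 (A (top c (suc i))) + 𝟙 (A (middle c (suc i))) + 𝟙 (A (top c i))

  size-Star : ∀ A v → HasSize (Star A v) (degree A v)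
  size-Star A (c , zero , false) = size-+ (size-bool _) (size-bool _)
  size-Star A (c , suc i , false) = size-+ (size-+ (size-bool _) (size-bool _)) (size-bool _)
  size-Star A (c , zero , true) = size-+ (size-bool _) (size-bool _)
  size-Star A (c , suc i , true) = size-+ (size-+ (size-bool _) (size-bool _)) (size-bool _)

  Incidences : Subset (Edge n) → Vertex n → Set
  Incidences A v = Σ (Edge n) λ e → (A e ≡ true) × Incident e v

  to-Star : ∀ A v → Incidences A v → Star A v
  to-Star A (c , zero , false) (bottom .c .0 , a , inj₁ refl) = inj₁ a
  to-Star A (c , zero , false) (middle .c .0 , a , inj₁ refl) = inj₂ a
  to-Star A (c , zero , false) (bottom _ _ , a , inj₂ ())
  to-Star A (c , zero , false) (top _ _ , a , inj₂ ())
  to-Star A (c , zero , false) (middle _ _ , a , inj₂ ())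
  to-Star A (c , suc i , false) (bottom .c .(suc i) , a , inj₁ refl) = inj₁ (inj₁ a)
  to-Star A (c , suc i , false) (middle .c .(suc i) , a , inj₁ refl) = inj₁ (inj₂ a)
  to-Star A (c , suc i , false) (bottom .c .i , a , inj₂ refl) = inj₂ a
  to-Star A (c , zero , true) (top .c .0 , a , inj₁ refl) = inj₁ a
  to-Star A (c , zero , true) (middle .c .0 , a , inj₂ refl) = inj₂ a
  to-Star A (c , suc i , true) (top .c .(suc i) , a , inj₁ refl) = inj₁ (inj₁ a)
  to-Star A (c , suc i , true) (middle .c .(suc i) , a , inj₂ refl) = inj₁ (inj₂ a)
  to-Star A (c , suc i , true) (top .c .i , a , inj₂ refl) = inj₂ a

  from-Star : ∀ A v → Star A v → Incidences A v
  from-Star A (c , zero , false) (inj₁ a) = bottom c 0 , a , inj₁ refl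
  from-Star A (c , zero , false) (inj₂ a) = middle c 0 , a , inj₁ refl
  from-Star A (c , suc i , false) (inj₁ (inj₁ a)) = bottom c (suc i) , a , inj₁ refl
  from-Star A (c , suc i , false) (inj₁ (inj₂ a)) = middle c (suc i) , a , inj₁ refl
  from-Star A (c , suc i , false) (inj₂ a) = bottom c i , a , inj₂ refl
  from-Star A (c , zero , true) (inj₁ a) = top c 0 , a , inj₁ refl
  from-Star A (c , zero , true) (inj₂ a) = middle c 0 , a , inj₂ refl
  from-Star A (c , suc i , true) (inj₁ (inj₁ a)) = top c (suc i) , a , inj₁ refl
  from-Star A (c , suc i , true) (inj₁ (inj₂ a)) = middle c (suc i) , a , inj₂ refl
  from-Star A (c , suc i , true) (inj₂ a) = top c i , a , inj₂ refl

  to∘from-Star : ∀ A v y → to-Star A v (from-Star A v y) ≡ y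
  to∘from-Star A (c , zero , false) (inj₁ a) = refl
  to∘from-Star A (c , zero , false) (inj₂ a) = refl
  to∘from-Star A (c , suc i , false) (inj₁ (inj₁ a)) = refl
  to∘from-Star A (c , suc i , false) (inj₁ (inj₂ a)) = refl
  to∘from-Star A (c , suc i , false) (inj₂ a) = refl
  to∘from-Star A (c , zero , true) (inj₁ a) = refl
  to∘from-Star A (c , zero , true) (inj₂ a) = refl
  to∘from-Star A (c , suc i , true) (inj₁ (inj₁ a)) = refl
  to∘from-Star A (c , suc i , true) (inj₁ (inj₂ a)) = refl
  to∘from-Star A (c , suc i , true) (inj₂ a) = refl

  from∘to-Star : ∀ A v x → from-Star A v (to-Star A v x) ≡ x
  from∘to-Star A (c , zero , false) (bottom .c .0 , a , inj₁ refl) = refl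
  from∘to-Star A (c , zero , false) (middle .c .0 , a , inj₁ refl) = refl
  from∘to-Star A (c , zero , false) (bottom _ _ , a , inj₂ ())
  from∘to-Star A (c , zero , false) (top _ _ , a , inj₂ ())
  from∘to-Star A (c , zero , false) (middle _ _ , a , inj₂ ())
  from∘to-Star A (c , suc i , false) (bottom .c .(suc i) , a , inj₁ refl) = refl
  from∘to-Star A (c , suc i , false) (middle .c .(suc i) , a , inj₁ refl) = refl
  from∘to-Star A (c , suc i , false) (bottom .c .i , a , inj₂ refl) = refl
  from∘to-Star A (c , zero , true) (top .c .0 , a , inj₁ refl) = refl
  from∘to-Star A (c , zero , true) (middle .c .0 , a , inj₂ refl) = refl
  from∘to-Star A (c , suc i , true) (top .c .(suc i) , a , inj₁ refl) = refl
  from∘to-Star A (c , suc i , true) (middle .c .(suc i) , a , inj₂ refl) = refl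
  from∘to-Star A (c , suc i , true) (top .c .i , a , inj₂ refl) = refl

  Incidences↔Star : ∀ A v → Incidences A v ↔ Star A v
  Incidences↔Star A v = mk↔ₛ′ (to-Star A v) (from-Star A v) (to∘from-Star A v) (from∘to-Star A v)

  size-Incidences : ∀ A v → HasSize (Incidences A v) (degree A v)
  size-Incidences A v = ↔-trans (Incidences↔Star A v) (size-Star A v)

half : ∀ k → parity k ≡ 0ℙ → Σ ℕ λ m → k ≡ 2 ℕ.* m
half zero p = 0 , refl
half (suc (suc k)) p with half k p
... | m , refl = suc m , cong suc (sym (+-suc m (m + 0)))

module _ {n : ℕ} where
  evenDegree⇒ : ∀ (A : Subset (Edge n)) v → EvenDegree A v → parity (degree A v) ≡ 0ℙ
  evenDegree⇒ A v (m , h) rewrite size-unique (size-Incidences A v) h = *-homo-* 2 m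

  evenDegree⇐ : ∀ (A : Subset (Edge n)) v → parity (degree A v) ≡ 0ℙ → EvenDegree A v
  evenDegree⇐ A v p with half _ p
  ... | m , eq = m , resize eq (size-Incidences A v)

-- Cycles inside one copy

-- A set h of rail positions of copy c determines an even-degree edge set:
-- both rails at the positions in h, and the rungs at the boundary of h
-- (positions where membership in h changes).  Rectangles and U's are the
-- cycles whose rail sets are intervals.

boundary : (ℕ → Bool) → ℕ → Bool
boundary h zero = h zero
boundary h (suc i) = h (suc i) xor h i

boundary-xor : ∀ f g i → boundary (λ j → f j xor g j) i ≡ boundary f i xor boundary g i
boundary-xor f g zero = refl
boundary-xor f g (suc i) = xor-interchange (f (suc i)) (g (suc i)) (f i) (g i)

onwards : ℕ → ℕ → Bool
onwards r i = r ℕ.≤ᵇ i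

onwards-true : ∀ {r i} → r ≤ i → onwards r i ≡ true
onwards-true r≤i = Equivalence.to T-≡ (≤⇒≤ᵇ r≤i)

onwards-sound : ∀ {r i} → onwards r i ≡ true → r ≤ i
onwards-sound {r} {i} p = ≤ᵇ⇒≤ r i (Equivalence.from T-≡ p)

onwards-false : ∀ {r i} → ¬ r ≤ i → onwards r i ≡ false
onwards-false r≰i = ¬true⇒false (λ p → r≰i (onwards-sound p))

boundary-onwards : ∀ r i → boundary (onwards r) i ≡ true → i ≡ r
boundary-onwards zero zero p = refl
boundary-onwards (suc r) zero p = ⊥-elim (clash p (onwards-false {suc r} {0} λ ()))
boundary-onwards r (suc i) p with r ≤? i | r ≤? suc i
... | yes r≤i | _ = ⊥-elim (clash p (cong₂ _xor_ (onwards-true (m≤n⇒m≤1+n r≤i)) (onwards-true r≤i)))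
... | no r≰i | no r≰1+i = ⊥-elim (clash p (cong₂ _xor_ (onwards-false r≰1+i) (onwards-false r≰i)))
... | no r≰i | yes r≤1+i = [ (λ r<1+i → ⊥-elim (r≰i (≤-pred r<1+i))) , sym ]′ (m≤n⇒m<n∨m≡n r≤1+i)

boundary-onwards-self : ∀ r → boundary (onwards r) r ≡ true
boundary-onwards-self zero = refl
boundary-onwards-self (suc r) =
  cong₂ _xor_ (onwards-true {suc r} ≤-refl) (onwards-false {suc r} {r} (<-irrefl refl))

boundary-onwards-other : ∀ r i → ¬ i ≡ r → boundary (onwards r) i ≡ false
boundary-onwards-other r i i≢r = ¬true⇒false (λ p → i≢r (boundary-onwards r i p))

between : ℕ → ℕ → ℕ → Bool
between r s i = onwards r i xor onwards s i

between-range : ∀ r s i → r ≤ s → between r s i ≡ true → r ≤ i × i < s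
between-range r s i r≤s p with r ≤? i | s ≤? i
... | yes r≤i | no s≰i = r≤i , ≰⇒> s≰i
... | no r≰i | yes s≤i = ⊥-elim (r≰i (≤-trans r≤s s≤i))
... | yes r≤i | yes s≤i = ⊥-elim (clash p (cong₂ _xor_ (onwards-true r≤i) (onwards-true s≤i)))
... | no r≰i | no s≰i = ⊥-elim (clash p (cong₂ _xor_ (onwards-false r≰i) (onwards-false s≰i)))

boundary-between : ∀ r s i → boundary (between r s) i ≡ true → i ≡ r ⊎ i ≡ s
boundary-between r s i p = one-of (trans (sym (boundary-xor (onwards r) (onwards s) i)) p)
  where
  one-of : boundary (onwards r) i xor boundary (onwards s) i ≡ true → i ≡ r ⊎ i ≡ s
  one-of q with boundary (onwards r) i in br | boundary (onwards s) i in bs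
  ... | true | _ = inj₁ (boundary-onwards r i br)
  ... | false | true = inj₂ (boundary-onwards s i bs)

-- the degrees of cycleOf below are of these two shapes
even-double : ∀ x → parity (𝟙 x + 𝟙 x) ≡ 0ℙ
even-double true = refl
even-double false = refl

even-triangle : ∀ x y → parity (𝟙 x + 𝟙 (x xor y) + 𝟙 y) ≡ 0ℙ
even-triangle true true = refl
even-triangle true false = refl
even-triangle false true = refl
even-triangle false false = refl

module _ {n : ℕ} where
  cycleOf : Fin n → (ℕ → Bool) → Subset (Edge n)
  cycleOf c h (bottom c' i) = eqFin c' c ∧ h i
  cycleOf c h (top c' i) = eqFin c' c ∧ h i
  cycleOf c h (middle c' i) = eqFin c' c ∧ boundary h i

  cycleOf-even : ∀ c h v → parity (degree (cycleOf c h) v) ≡ 0ℙ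
  cycleOf-even c h (c' , zero , false) with eqFin c' c
  ... | true = even-double (h 0)
  ... | false = refl
  cycleOf-even c h (c' , suc i , false) with eqFin c' c
  ... | true = even-triangle (h (suc i)) (h i)
  ... | false = refl
  cycleOf-even c h (c' , zero , true) with eqFin c' c
  ... | true = even-double (h 0)
  ... | false = refl
  cycleOf-even c h (c' , suc i , true) with eqFin c' c
  ... | true = even-triangle (h (suc i)) (h i)
  ... | false = refl

  cycleOf-cycle : ∀ c h r → boundary h r ≡ true → AlgebraicCycle (cycleOf c h)
  cycleOf-cycle c h r br =
    (middle c r , ∧-intro (eqFin-refl c) br) , λ v → evenDegree⇐ (cycleOf c h) v (cycleOf-even c h v)

  cycleOf-⊆ : ∀ S c h → (∀ i → h i ≡ true → rails S c i ≡ true) →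
              (∀ i → boundary h i ≡ true → S (middle c i) ≡ true) → cycleOf c h ⊆ S
  cycleOf-⊆ S c h hr hm (bottom c' i) p with ∧-elim {eqFin c' c} p
  ... | c'≡c , hi with eqFin-sound {c' = c'} {c} c'≡c
  ... | refl = proj₁ (∧-elim (hr i hi))
  cycleOf-⊆ S c h hr hm (top c' i) p with ∧-elim {eqFin c' c} p
  ... | c'≡c , hi with eqFin-sound {c' = c'} {c} c'≡c
  ... | refl = proj₂ (∧-elim {S (bottom c i)} (hr i hi))
  cycleOf-⊆ S c h hr hm (middle c' i) p with ∧-elim {eqFin c' c} p
  ... | c'≡c , bi with eqFin-sound {c' = c'} {c} c'≡c
  ... | refl = hm i bi

  Dependent : Subset (Edge n) → Set
  Dependent S = Σ (Subset (Edge n)) λ A → AlgebraicCycle A × A ⊆ S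

  U⇒dependent : ∀ S c r → InfiniteU S c r → Dependent S
  U⇒dependent S c r (rung , rl) =
    cycleOf c (onwards r) , cycleOf-cycle c (onwards r) r (boundary-onwards-self r) ,
    cycleOf-⊆ S c (onwards r) (λ i p → rl i (onwards-sound p))
                              (λ i p → subst (λ x → S (middle c x) ≡ true) (sym (boundary-onwards r i p)) rung)

  closes⇒dependent : ∀ S c N → closes S c N ≡ true →
                     Σ (Subset (Edge n)) λ A → AlgebraicCycle A × A ⊆ S × Below A (suc (suc N))
  closes⇒dependent S c N p with ∧-elim {linked S c N} p
  ... | lk , q with ∧-elim {rails S c N} q | linked⇒Link S c N lk
  ... | railsN , rungN | r , r≤N , rungr , rl =
    cycleOf c h , cycleOf-cycle c h r rung-r , cycleOf-⊆ S c h inRails inRungs , below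
    where
    h = between r (suc N)
    r≤1+N = m≤n⇒m≤1+n r≤N
    rung-r : boundary h r ≡ true
    rung-r = trans (boundary-xor (onwards r) (onwards (suc N)) r)
      (cong₂ _xor_ (boundary-onwards-self r) (boundary-onwards-other (suc N) r (<⇒≢ (s≤s r≤N))))
    inRails : ∀ i → h i ≡ true → rails S c i ≡ true
    inRails i hi with between-range r (suc N) i r≤1+N hi
    ... | r≤i , i<1+N = [ rl i r≤i , (λ { refl → railsN }) ]′ (m≤n⇒m<n∨m≡n (≤-pred i<1+N))
    inRungs : ∀ i → boundary h i ≡ true → S (middle c i) ≡ true
    inRungs i bi = [ (λ { refl → rungr }) , (λ { refl → rungN }) ]′ (boundary-between r (suc N) i bi)
    below : Below (cycleOf c h) (suc (suc N))
    rail-below : ∀ i → h i ≡ true → i < suc (suc N)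
    rail-below i hi = s≤s (<⇒≤ (proj₂ (between-range r (suc N) i r≤1+N hi)))
    below (bottom c' i) p = rail-below i (proj₂ (∧-elim {eqFin c' c} p))
    below (top c' i) p = rail-below i (proj₂ (∧-elim {eqFin c' c} p))
    below (middle c' i) p = [ (λ { refl → s≤s r≤1+N }) , (λ { refl → ≤-refl }) ]′
                              (boundary-between r (suc N) i (proj₂ (∧-elim {eqFin c' c} p)))

  independent⇒ : ∀ S → AC-Independent n S → LadderIndependent S
  independent⇒ S ind = (λ c N → ¬true⇒false (λ p → ind (dropBound (closes⇒dependent S c N p))))
                     , λ c r u → ind (U⇒dependent S c r u)
    where
    dropBound : ∀ {W} → (Σ (Subset (Edge n)) λ A → AlgebraicCycle A × A ⊆ S × Below A W) → Dependent S
    dropBound (A , cyc , sub , _) = A , cyc , sub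

-- Ladder-independent sets are AC-independent

parity-pair : ∀ x y → parity (𝟙 x + 𝟙 y) ≡ 0ℙ → x ≡ y
parity-pair true true p = refl
parity-pair false false p = refl

parity-triple : ∀ x y z → parity (𝟙 x + 𝟙 y + 𝟙 z) ≡ 0ℙ → x ≡ y xor z
parity-triple true true false p = refl
parity-triple true false true p = refl
parity-triple false true true p = refl
parity-triple false false false p = refl

-- An even-degree A inside a rectangle-free, U-free S has no bottom edge in
-- copy c: the parity constraints make both rails of A agree and propagate a
-- bottom edge at N to every later position, unless a rung of A closes a
-- rectangle; so A would contain an infinite U.
module EvenInside {n : ℕ} (S A : Subset (Edge n)) (free : RectangleFree S) (uFree : UFree S)
                  (even : ∀ v → EvenDegree A v) (A⊆S : A ⊆ S) (c : Fin n) where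
  b t m : ℕ → Bool
  b i = A (bottom c i)
  t i = A (top c i)
  m i = A (middle c i)

  b₀ : b 0 ≡ m 0
  b₀ = parity-pair _ _ (evenDegree⇒ A (c , 0 , false) (even _))

  t₀ : t 0 ≡ m 0
  t₀ = parity-pair _ _ (evenDegree⇒ A (c , 0 , true) (even _))

  b-suc : ∀ i → b (suc i) ≡ m (suc i) xor b i
  b-suc i = parity-triple _ _ _ (evenDegree⇒ A (c , suc i , false) (even _))

  t-suc : ∀ i → t (suc i) ≡ m (suc i) xor t i
  t-suc i = parity-triple _ _ _ (evenDegree⇒ A (c , suc i , true) (even _))

  b≡t : ∀ i → b i ≡ t i
  b≡t zero = trans b₀ (sym t₀)
  b≡t (suc i) = trans (b-suc i) (trans (cong (m (suc i) xor_) (b≡t i)) (sym (t-suc i)))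

  rails-of-b : ∀ i → b i ≡ true → rails A c i ≡ true
  rails-of-b i p = ∧-intro p (trans (sym (b≡t i)) p)

  b⇒linked : ∀ N → b N ≡ true → linked A c N ≡ true
  b⇒linked zero p = trans (sym b₀) p
  b⇒linked (suc N) p with m (suc N) in rung
  ... | true = refl
  ... | false = ∧-intro (b⇒linked N q) (rails-of-b N q)
    where
    q : b N ≡ true
    q = trans (sym (trans (b-suc N) (cong (_xor b N) rung))) p

  -- no rung of A closes a rectangle, so a bottom edge persists to the right
  b-persists : ∀ N → b N ≡ true → ∀ d → b (N + d) ≡ true
  b-persists N p zero rewrite +-identityʳ N = p
  b-persists N p (suc d) rewrite +-suc N d with m (suc (N + d)) in rung
  ... | true = ⊥-elim (clash (∧-intro (b⇒linked _ ih) (∧-intro (rails-of-b _ ih) rung))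
                             (rectangleFree-anti {S = A} {S' = S} (⊆⇒≼ A⊆S) free c (N + d)))
    where ih = b-persists N p d
  ... | false = trans (b-suc (N + d)) (trans (cong (_xor b (N + d)) rung) (b-persists N p d))

  no-bottom : ∀ N → b N ≡ true → ⊥
  no-bottom N p with linked⇒Link A c N (b⇒linked N p)
  ... | r , _ , rung , rl = uFree c r (U-mono {S = A} {S' = S} (⊆⇒≼ A⊆S) c r (rung , allRails))
    where
    allRails : ∀ l → r ≤ l → rails A c l ≡ true
    allRails l r≤l with l <? N
    ... | yes l<N = rl l r≤l l<N
    ... | no l≮N = subst (λ x → rails A c x ≡ true) (m+[n∸m]≡n (≮⇒≥ l≮N))
                         (rails-of-b _ (b-persists N p (l ∸ N)))

  some-bottom : ∀ e → copy e ≡ c → A e ≡ true → Σ ℕ λ N → b N ≡ true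
  some-bottom (bottom .c i) refl p = i , p
  some-bottom (top .c i) refl p = i , trans (b≡t i) p
  some-bottom (middle .c zero) refl p = 0 , trans b₀ p
  some-bottom (middle .c (suc i)) refl p with b i in bi
  ... | true = i , bi
  ... | false = suc i , trans (b-suc i) (cong₂ _xor_ p bi)

independent⇐ : ∀ {n} S → LadderIndependent {n} S → AC-Independent n S
independent⇐ S (free , uFree) (A , ((e , e∈A) , even) , A⊆S) =
  let open EvenInside S A free uFree even A⊆S (copy e)
      N , bN = some-bottom e refl e∈A
  in no-bottom N bN

-- The weight of a rectangle-free copy

-- The contribution of position N to the weight below: the rails at N, the rung
-- at N + 1 and whether position N + 1 is unlinked, given whether N is linked (l).
step : (l b t m : Bool) → ℕ
step l b t m = 𝟙 b + 𝟙 t + 𝟙 m + 𝟙 (not (m ∨ (l ∧ (b ∧ t))))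

step-bound : ∀ l b t m → (l ∧ (b ∧ t) ∧ m) ≡ false → step l b t m ≤ 2 + 𝟙 (not l)
step-bound true true true true ()
step-bound true true true false _ = ≤-refl
step-bound true true false true _ = ≤-refl
step-bound true true false false _ = ≤-refl
step-bound true false true true _ = ≤-refl
step-bound true false true false _ = ≤-refl
step-bound true false false true _ = m≤m+n 1 1
step-bound true false false false _ = m≤m+n 1 1
step-bound false true true true _ = ≤-refl
step-bound false true true false _ = ≤-refl
step-bound false true false true _ = m≤m+n 2 1
step-bound false true false false _ = m≤m+n 2 1
step-bound false false true true _ = m≤m+n 2 1
step-bound false false true false _ = m≤m+n 2 1
step-bound false false false true _ = m≤m+n 1 2
step-bound false false false false _ = m≤m+n 1 2

step-exact : ∀ l b t m → (l ∧ (b ∧ t) ∧ m) ≡ false →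
  ((t ≡ false ⊎ l ≡ false) → b ≡ true) → ((b ≡ false ⊎ l ≡ false) → t ≡ true) →
  step l b t m ≡ 2 + 𝟙 (not l)
step-exact true true true true () _ _
step-exact true true true false _ _ _ = refl
step-exact true true false true _ _ _ = refl
step-exact true true false false _ _ _ = refl
step-exact true false true true _ _ _ = refl
step-exact true false true false _ _ _ = refl
step-exact true false false m _ hb _ with hb (inj₁ refl)
... | ()
step-exact false true true true _ _ _ = refl
step-exact false true true false _ _ _ = refl
step-exact false true false m _ _ ht with ht (inj₂ refl)
... | ()
step-exact false false t m _ hb _ with hb (inj₂ refl)
... | ()

module _ {n : ℕ} where
  edgesUpTo : Subset (Edge n) → Fin n → ℕ → ℕ
  edgesUpTo S c N = edgesIn S c N + 𝟙 (S (middle c N))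

  unlinked : Subset (Edge n) → Fin n → ℕ → ℕ
  unlinked S c N = 𝟙 (not (linked S c N))

  weight : Subset (Edge n) → Fin n → ℕ → ℕ
  weight S c N = edgesUpTo S c N + 1 + unlinked S c N

  Saturated : Subset (Edge n) → Fin n → Set
  Saturated S c = ∀ s N → (S (rail (not s) c N) ≡ false ⊎ linked S c N ≡ false) → S (rail s c N) ≡ true

  stepAt : Subset (Edge n) → Fin n → ℕ → ℕ
  stepAt S c N = step (linked S c N) (S (bottom c N)) (S (top c N)) (S (middle c (suc N)))

  stepAt-bound : ∀ S c N → RectangleFree S → stepAt S c N ≤ 2 + unlinked S c N
  stepAt-bound S c N free = step-bound (linked S c N) (S (bottom c N)) (S (top c N)) _ (free c N)

  stepAt-exact : ∀ S c N → RectangleFree S → Saturated S c → stepAt S c N ≡ 2 + unlinked S c N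
  stepAt-exact S c N free sat =
    step-exact (linked S c N) (S (bottom c N)) (S (top c N)) _ (free c N) (sat false N) (sat true N)

  weight-step : ∀ S c N → weight S c (suc N) + unlinked S c N ≡ weight S c N + stepAt S c N
  weight-step S c N rewrite sumBelow-snoc (atPos S c) N =
    regroup (edgesIn S c N) (𝟙 (S (bottom c N))) (𝟙 (S (top c N))) (𝟙 (S (middle c N)))
            (𝟙 (S (middle c (suc N)))) (unlinked S c N) (unlinked S c (suc N))
    where
    regroup : ∀ X b t m m' a a' → X + (b + t + m) + m' + 1 + a' + a ≡ X + m + 1 + a + (b + t + m' + a')
    regroup = solve-∀

  private
    two-more : ∀ N a → suc N + suc N + (2 + a) ≡ suc (suc N) + suc (suc N) + a
    two-more = solve-∀

  weight-bound : ∀ S c → RectangleFree S → ∀ N → weight S c N ≤ suc N + suc N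
  weight-bound S c free zero with S (middle c 0)
  ... | true = ≤-refl
  ... | false = ≤-refl
  weight-bound S c free (suc N) = +-cancelʳ-≤ (unlinked S c N) _ _ (begin
    weight S c (suc N) + unlinked S c N ≡⟨ weight-step S c N ⟩
    weight S c N + stepAt S c N         ≤⟨ +-mono-≤ (weight-bound S c free N) (stepAt-bound S c N free) ⟩
    suc N + suc N + (2 + unlinked S c N) ≡⟨ two-more N _ ⟩
    suc (suc N) + suc (suc N) + unlinked S c N ∎)
    where open ≤-Reasoning

  weight-saturated : ∀ S c → RectangleFree S → Saturated S c → ∀ N → weight S c N ≡ suc N + suc N
  weight-saturated S c free sat zero with S (middle c 0)
  ... | true = refl
  ... | false = refl
  weight-saturated S c free sat (suc N) = +-cancelʳ-≡ (unlinked S c N) _ _ (begin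
    weight S c (suc N) + unlinked S c N ≡⟨ weight-step S c N ⟩
    weight S c N + stepAt S c N
      ≡⟨ cong₂ _+_ (weight-saturated S c free sat N) (stepAt-exact S c N free sat) ⟩
    suc N + suc N + (2 + unlinked S c N) ≡⟨ two-more N _ ⟩
    suc (suc N) + suc (suc N) + unlinked S c N ∎)
    where open ≡-Reasoning

module _ {n : ℕ} where
  _≟ₑ_ : (e x : Edge n) → Dec (e ≡ x)
  bottom c i ≟ₑ bottom c' j = map′ (λ { (refl , refl) → refl }) (λ { refl → refl , refl }) (c Fin.≟ c' ×-dec i ≟ j)
  top c i ≟ₑ top c' j       = map′ (λ { (refl , refl) → refl }) (λ { refl → refl , refl }) (c Fin.≟ c' ×-dec i ≟ j)
  middle c i ≟ₑ middle c' j = map′ (λ { (refl , refl) → refl }) (λ { refl → refl , refl }) (c Fin.≟ c' ×-dec i ≟ j)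
  bottom _ _ ≟ₑ top _ _ = no λ ()
  bottom _ _ ≟ₑ middle _ _ = no λ ()
  top _ _ ≟ₑ bottom _ _ = no λ ()
  top _ _ ≟ₑ middle _ _ = no λ ()
  middle _ _ ≟ₑ bottom _ _ = no λ ()
  middle _ _ ≟ₑ top _ _ = no λ ()

  insert : Subset (Edge n) → Edge n → Subset (Edge n)
  insert S x e = S e ∨ does (e ≟ₑ x)

  insert-⊇ : ∀ S x → S ⊆ insert S x
  insert-⊇ S x e p = ∨-inl _ p

  insert-new : ∀ S x → insert S x x ≡ true
  insert-new S x = ∨-inr (S x) (dec-true (x ≟ₑ x) refl)

  insert-old : ∀ S x e → ¬ e ≡ x → insert S x e ≡ S e
  insert-old S x e e≢x = trans (cong (S e ∨_) (dec-false (e ≟ₑ x) e≢x)) (∨-identityʳ (S e))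

  insert-elim : ∀ S x e → insert S x e ≡ true → S e ≡ true ⊎ e ≡ x
  insert-elim S x e p with ∨-elim {S e} p
  ... | inj₁ q = inj₁ q
  ... | inj₂ q with e ≟ₑ x
  ... | yes e≡x = inj₂ e≡x

  -- If the opposite rail is missing there, or
  -- N0 is not linked, no link can pass through N0, so neither a rectangle nor
  -- an infinite U is created.
  module InsertRail (S : Subset (Edge n)) (s : Bool) (c : Fin n) (N0 : ℕ) where
    S' : Subset (Edge n)
    S' = insert S (rail s c N0)

    rung-same : ∀ c' j → S' (middle c' j) ≡ S (middle c' j)
    rung-same c' j = insert-old S _ (middle c' j) (λ eq → rung≢rail s eq)
      where
      rung≢rail : ∀ s → ¬ middle c' j ≡ rail s c N0
      rung≢rail false ()
      rung≢rail true ()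

    rails-same : ∀ c' l → ¬ (c' ≡ c × l ≡ N0) → rails S' c' l ≡ rails S c' l
    rails-same c' l elsewhere =
      cong₂ _∧_ (insert-old S _ (bottom c' l) (bottom≢ s)) (insert-old S _ (top c' l) (top≢ s))
      where
      bottom≢ : ∀ s → ¬ bottom c' l ≡ rail s c N0
      bottom≢ false refl = elsewhere (refl , refl)
      bottom≢ true ()
      top≢ : ∀ s → ¬ top c' l ≡ rail s c N0
      top≢ false ()
      top≢ true refl = elsewhere (refl , refl)

    rails-new : rails S' c N0 ≡ true → S (rail (not s) c N0) ≡ true
    rails-new = opposite s
      where
      opposite : ∀ s → rails (insert S (rail s c N0)) c N0 ≡ true → S (rail (not s) c N0) ≡ true
      opposite false p = trans (sym (insert-old S (bottom c N0) (top c N0) (λ ())))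
                               (proj₂ (∧-elim {insert S (bottom c N0) (bottom c N0)} p))
      opposite true p = trans (sym (insert-old S (top c N0) (bottom c N0) (λ ()))) (proj₁ (∧-elim p))

    module Safe (safe : (S (rail (not s) c N0) ≡ false) ⊎ (linked S c N0 ≡ false)) where
      unsafe : S (rail (not s) c N0) ≡ true → linked S c N0 ≡ true → ⊥
      unsafe p q = [ clash p , clash q ]′ safe

      no-run : ∀ r → r ≤ N0 → S' (middle c r) ≡ true →
               (∀ l → r ≤ l → l ≤ N0 → rails S' c l ≡ true) → ⊥
      no-run r r≤ rung rl = unsafe (rails-new (rl N0 r≤ ≤-refl))
        (Link⇒linked S c N0 (r , r≤ , trans (sym (rung-same c r)) rung ,
          λ l a b → trans (sym (rails-same c l (λ { (_ , refl) → <-irrefl refl b }))) (rl l a (<⇒≤ b))))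

      Link-back : ∀ c' M → Link S' c' M → Link S c' M
      Link-back c' M (r , r≤M , rung , rl) = r , r≤M , trans (sym (rung-same c' r)) rung ,
          λ l a b → trans (sym (rails-same c' l (not-N0 l a b))) (rl l a b)
        where
        not-N0 : ∀ l → r ≤ l → l < M → ¬ (c' ≡ c × l ≡ N0)
        not-N0 l a b (refl , refl) = no-run r a rung (λ l' a' b' → rl l' a' (≤-<-trans b' b))

      closes-back : ∀ c' M → ¬ (c' ≡ c × M ≡ N0) → closes S' c' M ≡ true → closes S c' M ≡ true
      closes-back c' M elsewhere p with ∧-elim {linked S' c' M} p
      ... | lk , q with ∧-elim {rails S' c' M} q
      ... | rl , rung = ∧-intro (Link⇒linked S c' M (Link-back c' M (linked⇒Link S' c' M lk)))
                          (∧-intro (trans (sym (rails-same c' M elsewhere)) rl)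
                                   (trans (sym (rung-same c' (suc M))) rung))

      -- at (c, N0) itself, a rectangle would need a link of S and the opposite rail
      no-rectangle-at-N0 : closes S' c N0 ≡ true → ⊥
      no-rectangle-at-N0 p with ∧-elim {linked S' c N0} p
      ... | lk , q = unsafe (rails-new (proj₁ (∧-elim q)))
                            (Link⇒linked S c N0 (Link-back c N0 (linked⇒Link S' c N0 lk)))

      rectangleFree : RectangleFree S → RectangleFree S'
      rectangleFree free c' M = ¬true⇒false closed
        where
        closed : closes S' c' M ≡ true → ⊥
        closed p with c' Fin.≟ c | M ≟ N0
        ... | yes refl | yes refl = no-rectangle-at-N0 p
        ... | yes refl | no M≢N0 = clash (closes-back c' M (λ { (_ , e) → M≢N0 e }) p) (free c' M)
        ... | no c'≢c | _ = clash (closes-back c' M (λ { (e , _) → c'≢c e }) p) (free c' M)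

      uFree : UFree S → UFree S'
      uFree free c' r (rung , rl) with c' Fin.≟ c | r ≤? N0
      ... | yes refl | yes r≤ = no-run r r≤ rung (λ l a _ → rl l a)
      ... | yes refl | no r≰ = free c' r (trans (sym (rung-same c' r)) rung ,
              λ l a → trans (sym (rails-same c' l (λ { (_ , refl) → r≰ a }))) (rl l a))
      ... | no c'≢c | _ = free c' r (trans (sym (rung-same c' r)) rung ,
              λ l a → trans (sym (rails-same c' l (λ { (e , _) → c'≢c e }))) (rl l a))

-- The finitarization of M_n[k] consists of the rectangle-free sets

Trunc : ∀ n → ℕ → Family (Edge n)
Trunc n k = truncate (AC-Independent n) k

AC-Independent-anti : ∀ {n} {S S' : Subset (Edge n)} → S ⊆ S' → AC-Independent n S' → AC-Independent n S
AC-Independent-anti sub ind (A , cyc , A⊆S) = ind (A , cyc , λ e p → sub e (A⊆S e p))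

module _ {n : ℕ} where
  _∪_ : Subset (Edge n) → Subset (Edge n) → Subset (Edge n)
  (S ∪ S') e = S e ∨ S' e

  below⇒uFree : ∀ (X : Subset (Edge n)) W → Below X W → UFree X
  below⇒uFree X W below c r (_ , rl) =
    <-irrefl refl (<-≤-trans (below _ (proj₂ (∧-elim {X (bottom c (r + W))} (rl (r + W) (m≤m+n r W)))))
                             (m≤n+m W r))

  below⇒independent : ∀ X W → Below X W → RectangleFree X → AC-Independent n X
  below⇒independent X W below free = independent⇐ X (free , below⇒uFree X W below)

  -- a rectangle of S gives a finite subset of S that is not independent
  finitary⇒rectangleFree : ∀ k S → finitarization (Trunc n k) S → RectangleFree S
  finitary⇒rectangleFree k S finitary c N = ¬true⇒false λ p → dependent (closes⇒dependent S c N p)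
    where
    dependent : (Σ (Subset (Edge n)) λ A → AlgebraicCycle A × A ⊆ S × Below A (suc (suc N))) → ⊥
    dependent (A , cyc , A⊆S , below) =
      proj₁ (finitary A (below⇒finite A _ below) A⊆S) (A , cyc , λ e p → p)

run : ∀ {n'} → ℕ → ℕ → Subset (Edge (suc n'))
run W k (bottom fz i) = between W (W + k) i
run W k (bottom (fs _) _) = false
run W k (top _ _) = false
run W k (middle _ _) = false

run-range : ∀ {n'} W k (e : Edge (suc n')) → run W k e ≡ true → W ≤ pos e × pos e < W + k
run-range W k (bottom fz i) p = between-range W (W + k) i (m≤m+n W k) p

run-beyond : ∀ {n'} W k (e : Edge (suc n')) → W + k ≤ pos e → run W k e ≡ false
run-beyond W k e le = ¬true⇒false (λ p → <-irrefl refl (<-≤-trans (proj₂ (run-range W k e p)) le))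

size-run : ∀ {n'} W k → HasSize (Elems (run {n'} W k)) k
size-run {n'} W k = ↔-trans positions (resize window (size-ℕ (between W (W + k)) (W + k)
  (λ i p → proj₂ (between-range W (W + k) i (m≤m+n W k) p))))
  where
  positions : Elems (run {n'} W k) ↔ Σ ℕ (λ i → between W (W + k) i ≡ true)
  positions = mk↔ₛ′ (λ { (bottom fz i , p) → i , p }) (λ { (i , p) → bottom fz i , p })
                    (λ _ → refl) (λ { (bottom fz i , p) → refl })
  window : sumBelow (λ i → 𝟙 (between W (W + k) i)) (W + k) ≡ k
  window = sumBelow-window _ W k
    (λ i i<W → cong 𝟙 (cong₂ _xor_ (onwards-false (<⇒≱ i<W))
                                   (onwards-false (<⇒≱ (<-≤-trans i<W (m≤m+n W k))))))
    (λ i i<k → cong 𝟙 (cong₂ _xor_ (onwards-true (m≤m+n W i)) (onwards-false (<⇒≱ (+-monoʳ-< W i<k)))))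

module _ {n' : ℕ} where
  private n = suc n'

  -- a finite rectangle-free X is independent in M_n[k]: far to the right,
  -- k bottom edges can be added to it without creating any cycle
  below⇒trunc : ∀ k X W → Below X W → RectangleFree X → Trunc n k X
  below⇒trunc k X W below free =
    below⇒independent X W below free , X ∪ run W k , independent⇐ (X ∪ run W k) (free' , uFree') ,
    (λ e p → ∨-inl _ p) ,
    ↔-trans (Diff↔∖ (X ∪ run W k) X) (↔-trans (Elems-cong _ _ extra) (size-run W k))
    where
    run-outside : ∀ e → run W k e ≡ true → X e ≡ false
    run-outside e p = ¬true⇒false (λ q → <-irrefl refl (<-≤-trans (below e q) (proj₁ (run-range W k e p))))
    shrink : (X ∪ run W k) ≼ X
    shrink = skeleton rails-back λ c i p → trans (sym (∨-identityʳ (X (middle c i)))) p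
      where
      top-back : ∀ c l → (X ∪ run W k) (top c l) ≡ true → X (top c l) ≡ true
      top-back c l p = trans (sym (∨-identityʳ (X (top c l)))) p
      rails-back : ∀ c l → rails (X ∪ run W k) c l ≡ true → rails X c l ≡ true
      rails-back c l p with ∧-elim {(X ∪ run W k) (bottom c l)} p
      ... | bl , tl with ∨-elim {X (bottom c l)} bl
      ... | inj₁ x = ∧-intro x (top-back c l tl)
      ... | inj₂ r = ⊥-elim (<-irrefl refl (<-≤-trans (below (top c l) (top-back c l tl))
                                                       (proj₁ (run-range W k (bottom c l) r))))
    free' : RectangleFree (X ∪ run W k)
    free' = rectangleFree-anti shrink free
    uFree' : UFree (X ∪ run W k)
    uFree' = uFree-anti shrink (below⇒uFree X W below)
    extra : ∀ e → ((X ∪ run W k) ∖ X) e ≡ run W k e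
    extra e with run W k e in r
    ... | true rewrite run-outside e r = refl
    ... | false with X e
    ... | true = refl
    ... | false = refl

  rectangleFree⇒finitary : ∀ k S → RectangleFree S → finitarization (Trunc n k) S
  rectangleFree⇒finitary k S free X finite X⊆S =
    below⇒trunc k X (proj₁ bound) (proj₂ bound) (rectangleFree-anti (⊆⇒≼ X⊆S) free)
    where bound = finite⇒below X finite

-- Saturation of bases

module _ {n' : ℕ} {k : ℕ} where
  private n = suc n'

  -- a base of the finitarization is saturated: a safe rail insertion keeps it
  -- rectangle-free, hence finitary, so by maximality the rail was there
  finitaryBase-saturated : ∀ F → IsBase (finitarization (Trunc n k)) F → ∀ c → Saturated F c
  finitaryBase-saturated F (finF , maxF) c s N safe = maxF S' finitary (insert-⊇ F _) _ (insert-new F _)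
    where
    open InsertRail F s c N
    finitary : finitarization (Trunc n k) S'
    finitary = rectangleFree⇒finitary k S' (Safe.rectangleFree safe (finitary⇒rectangleFree k F finF))

  -- the witness T ⊇ B of a base B of M_n[k] is saturated: a safe rail h ∉ T
  -- could be added to both B and T keeping |T ∖ B| = k, against maximality of B
  baseWitness-saturated : ∀ B T → IsBase (Trunc n k) B → AC-Independent n T → B ⊆ T →
                          HasSize (Diff T B) k → ∀ c → Saturated T c
  baseWitness-saturated B T (_ , maxB) indT B⊆T size c s N safe with T (rail s c N) in absent
  ... | true = refl
  ... | false = ⊥-elim (clash (B⊆T h (maxB B' B'∈Trunc (insert-⊇ B h) h (insert-new B h))) absent)
    where
    open InsertRail T s c N
    h = rail s c N
    B' = insert B h
    free = independent⇒ T indT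
    indT' : AC-Independent n S'
    indT' = independent⇐ S' (Safe.rectangleFree safe (proj₁ free) , Safe.uFree safe (proj₂ free))
    B'⊆T' : B' ⊆ S'
    B'⊆T' e p = [ (λ q → ∨-inl _ (B⊆T e q)) , (λ { refl → insert-new T h }) ]′ (insert-elim B h e p)
    same-difference : ∀ e → (S' ∖ B') e ≡ (T ∖ B) e
    same-difference e with e ≟ₑ h
    ... | yes refl rewrite absent | ∨-zeroʳ (B h) = refl
    ... | no _ rewrite ∨-identityʳ (T e) | ∨-identityʳ (B e) = refl
    B'∈Trunc : Trunc n k B'
    B'∈Trunc = AC-Independent-anti B'⊆T' indT' , S' , indT' , B'⊆T' ,
      ↔-trans (Diff↔∖ S' B') (↔-trans (Elems-cong _ _ same-difference)
                                        (↔-trans (↔-sym (Diff↔∖ T B)) size))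

-- Balance between two saturated supersets of a set

module _ {n : ℕ} where
  edgesUpTo-∖ : ∀ (S S' : Subset (Edge n)) → S ⊆ S' → ∀ c N →
                edgesUpTo S' c N ≡ edgesUpTo S c N + edgesUpTo (S' ∖ S) c N
  edgesUpTo-∖ S S' sub c N rewrite edgesIn-∖ S S' sub c N | 𝟙-split (S (middle c N)) (S' (middle c N)) (sub _) =
    regroup (edgesIn S c N) (edgesIn (S' ∖ S) c N) _ _
    where
    regroup : ∀ a b c d → a + b + (c + d) ≡ a + c + (b + d)
    regroup = solve-∀

  edgesUpTo-below : ∀ (S : Subset (Edge n)) W → Below S W → ∀ N → W ≤ N → ∀ c →
                    edgesUpTo S c N ≡ edgesIn S c N
  edgesUpTo-below S W below N W≤N c with S (middle c N) in rung
  ... | true = ⊥-elim (<-irrefl refl (<-≤-trans (below _ rung) W≤N))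
  ... | false = +-identityʳ _

  ΣedgesUpTo : Subset (Edge n) → ℕ → ℕ
  ΣedgesUpTo S N = sum (λ c → edgesUpTo S c N)

  ΣedgesUpTo-∖ : ∀ (S S' : Subset (Edge n)) → S ⊆ S' → ∀ N →
                 ΣedgesUpTo S' N ≡ ΣedgesUpTo S N + ΣedgesUpTo (S' ∖ S) N
  ΣedgesUpTo-∖ S S' sub N = trans (sum-cong-≗ {n} (λ c → edgesUpTo-∖ S S' sub c N))
                                  (∑-distrib-+ (λ c → edgesUpTo S c N) (λ c → edgesUpTo (S' ∖ S) c N))

  edges≤ΣedgesUpTo : ∀ (S : Subset (Edge n)) N → edges S N ≤ ΣedgesUpTo S N
  edges≤ΣedgesUpTo S N = sum-mono {f = λ c → edgesIn S c N} (λ c → m≤m+n (edgesIn S c N) (𝟙 (S (middle c N))))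

  edgesUpTo-compare : ∀ (S T : Subset (Edge n)) c N → RectangleFree S → RectangleFree T → Saturated T c →
                      (linked S c N ≡ true → linked T c N ≡ true) → edgesUpTo S c N ≤ edgesUpTo T c N
  edgesUpTo-compare S T c N freeS freeT satT S⇒T = +-cancelʳ-≤ (1 + unlinked T c N) _ _ (begin
    edgesUpTo S c N + (1 + unlinked T c N) ≤⟨ +-monoʳ-≤ (edgesUpTo S c N) (s≤s (unlinked-anti _ _ S⇒T)) ⟩
    edgesUpTo S c N + (1 + unlinked S c N) ≡⟨ sym (+-assoc (edgesUpTo S c N) 1 _) ⟩
    weight S c N                           ≤⟨ weight-bound S c freeS N ⟩
    suc N + suc N                          ≡⟨ sym (weight-saturated T c freeT satT N) ⟩
    weight T c N                           ≡⟨ +-assoc (edgesUpTo T c N) 1 _ ⟩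
    edgesUpTo T c N + (1 + unlinked T c N) ∎)
    where
    open ≤-Reasoning
    unlinked-anti : ∀ s t → (s ≡ true → t ≡ true) → 𝟙 (not t) ≤ 𝟙 (not s)
    unlinked-anti s true _ = z≤n
    unlinked-anti true false h with h refl
    ... | ()
    unlinked-anti false false _ = ≤-refl

  Σunlinked : Subset (Edge n) → ℕ → ℕ
  Σunlinked S N = sum (λ c → unlinked S c N)

  -- For saturated rectangle-free supersets F and T of B both weights equal
  -- 2N + 2, so the edges outside B balance against the unlinked positions.
  balance : ∀ (B F T : Subset (Edge n)) → B ⊆ F → B ⊆ T →
    RectangleFree F → (∀ c → Saturated F c) → RectangleFree T → (∀ c → Saturated T c) → ∀ N →
    ΣedgesUpTo (F ∖ B) N + Σunlinked F N ≡ ΣedgesUpTo (T ∖ B) N + Σunlinked T N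
  balance B F T B⊆F B⊆T freeF satF freeT satT N =
    trans (sym (∑-distrib-+ (λ c → edgesUpTo (F ∖ B) c N) (λ c → unlinked F c N)))
    (trans (sum-cong-≗ {n} per-copy) (∑-distrib-+ (λ c → edgesUpTo (T ∖ B) c N) (λ c → unlinked T c N)))
    where
    weight-∖ : ∀ S → B ⊆ S → ∀ c →
               edgesUpTo B c N + 1 + (edgesUpTo (S ∖ B) c N + unlinked S c N) ≡ weight S c N
    weight-∖ S B⊆S c = trans (regroup (edgesUpTo B c N) (edgesUpTo (S ∖ B) c N) (unlinked S c N))
                             (cong (λ x → x + 1 + unlinked S c N) (sym (edgesUpTo-∖ B S B⊆S c N)))
      where
      regroup : ∀ b d a → b + 1 + (d + a) ≡ b + d + 1 + a
      regroup = solve-∀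
    per-copy : ∀ c → edgesUpTo (F ∖ B) c N + unlinked F c N ≡ edgesUpTo (T ∖ B) c N + unlinked T c N
    per-copy c = +-cancelˡ-≡ (edgesUpTo B c N + 1) _ _ (begin
      edgesUpTo B c N + 1 + (edgesUpTo (F ∖ B) c N + unlinked F c N) ≡⟨ weight-∖ F B⊆F c ⟩
      weight F c N                                                    ≡⟨ weight-saturated F c freeF (satF c) N ⟩
      suc N + suc N                                                   ≡⟨ sym (weight-saturated T c freeT (satT c) N) ⟩
      weight T c N                                                    ≡⟨ sym (weight-∖ T B⊆T c) ⟩
      edgesUpTo B c N + 1 + (edgesUpTo (T ∖ B) c N + unlinked T c N) ∎)
      where open ≡-Reasoning

-- Every spectrum value is k + j with j ≤ n

-- Far enough out, the balance identity compares
-- |F ∖ B| with |T ∖ B| = k plus the number j of copies linked in F but not in T.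
module UpperBound {n' : ℕ} (LEM : ExcludedMiddle 0ℓ) (k : ℕ) (F B : Subset (Edge (suc n')))
  (baseF : IsBase (finitarization (Trunc (suc n') k)) F) (baseB : IsBase (Trunc (suc n') k) B)
  (B⊆F : B ⊆ F) where
  n = suc n'

  T : Subset (Edge n)
  T = proj₁ (proj₂ (proj₁ baseB))
  indT : AC-Independent n T
  indT = proj₁ (proj₂ (proj₂ (proj₁ baseB)))
  B⊆T : B ⊆ T
  B⊆T = proj₁ (proj₂ (proj₂ (proj₂ (proj₁ baseB))))
  size-T∖B : HasSize (Diff T B) k
  size-T∖B = proj₂ (proj₂ (proj₂ (proj₂ (proj₁ baseB))))

  freeF : RectangleFree F
  freeF = finitary⇒rectangleFree k F (proj₁ baseF)
  freeT : LadderIndependent T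
  freeT = independent⇒ T indT

  K D : Subset (Edge n)
  K = T ∖ B
  D = F ∖ B

  size-K : HasSize (Elems K) k
  size-K = ↔-trans (↔-sym (Diff↔∖ T B)) size-T∖B

  M₀ : ℕ
  M₀ = proj₁ (finite⇒below K (k , size-K))
  K-below : Below K M₀
  K-below = proj₂ (finite⇒below K (k , size-K))

  K-count : ∀ N → M₀ ≤ N → ΣedgesUpTo K N ≡ k
  K-count N le = trans (sum-cong-≗ {n} (edgesUpTo-below K M₀ K-below N le))
                       (size-unique (size-edges K N (λ e p → <-≤-trans (K-below e p) le)) size-K)

  -- F and T are saturated, so they balance
  balanceAt : ∀ N → ΣedgesUpTo D N + Σunlinked F N ≡ ΣedgesUpTo K N + Σunlinked T N
  balanceAt = balance B F T B⊆F B⊆T freeF (finitaryBase-saturated F baseF) (proj₁ freeT)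
                      (baseWitness-saturated B T baseB indT B⊆T size-T∖B)

  D-bounded : ∀ W → edges D W ≤ k + n
  D-bounded W = begin
    edges D W                            ≤⟨ edges-mono D (m≤m⊔n W M₀) ⟩
    edges D N                            ≤⟨ edges≤ΣedgesUpTo D N ⟩
    ΣedgesUpTo D N                       ≤⟨ m≤m+n _ _ ⟩
    ΣedgesUpTo D N + Σunlinked F N       ≡⟨ balanceAt N ⟩
    ΣedgesUpTo K N + Σunlinked T N       ≡⟨ cong (_+ Σunlinked T N) (K-count N (m≤n⊔m W M₀)) ⟩
    k + Σunlinked T N                    ≤⟨ +-monoʳ-≤ k (sum-𝟙≤ (λ c → not (linked T c N))) ⟩
    k + n                                ∎
    where
    open ≤-Reasoning
    N = W ⊔ M₀

  W_D : ℕ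
  W_D = proj₁ (bounded⇒below LEM D (k + n) D-bounded)
  D-below : Below D W_D
  D-below = proj₂ (bounded⇒below LEM D (k + n) D-bounded)

  -- T has no infinite U, so from each rung the rails of T break somewhere
  Breaks : Fin n → ℕ → ℕ → Set
  Breaks c r L = T (middle c r) ≡ true → Σ ℕ λ l → r ≤ l × l < L × rails T c l ≡ false

  breaks : ∀ c r → Σ ℕ (Breaks c r)
  breaks c r with LEM {Σ ℕ λ l → r ≤ l × rails T c l ≡ false}
  ... | yes (l , r≤l , gap) = suc l , λ _ → l , r≤l , ≤-refl , gap
  ... | no no-gap =
    0 , λ rung → ⊥-elim (proj₂ freeT c r (rung , λ l r≤l → ¬false⇒true (λ gap → no-gap (l , r≤l , gap))))

  Breaks-mono : ∀ c r {L L'} → L ≤ L' → Breaks c r L → Breaks c r L'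
  Breaks-mono c r le brk rung with brk rung
  ... | l , r≤l , l<L , gap = l , r≤l , <-≤-trans l<L le , gap

  common-break : Σ ℕ λ L → ∀ c (r : Fin M₀) → Breaks c (toℕ r) L
  common-break = eventually-all (λ c L → ∀ r → Breaks c (toℕ r) L) (λ c le q r → Breaks-mono c _ le (q r))
    λ c → eventually-all (λ r → Breaks c (toℕ r)) (λ r → Breaks-mono c (toℕ r)) (λ r → breaks c (toℕ r))

  L : ℕ
  L = proj₁ common-break

  breaks-before-L : ∀ c r → r < M₀ → Breaks c r L
  breaks-before-L c r r<M₀ =
    subst (λ x → Breaks c x L) (toℕ-fromℕ< r<M₀) (proj₂ common-break c (Fin.fromℕ< r<M₀))

  T-beyond : ∀ e → T e ≡ true → M₀ ≤ pos e → B e ≡ true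
  T-beyond e p le with B e in b
  ... | true = refl
  ... | false = ⊥-elim (<-irrefl refl (<-≤-trans (K-below e (cong₂ (λ x y → x ∧ not y) p b)) le))

  -- from L on, a link of T starts at a rung r ≥ M₀ and so is a link of B
  linkedT⇒linkedB : ∀ N → L ≤ N → ∀ c → linked T c N ≡ true → linked B c N ≡ true
  linkedT⇒linkedB N L≤N c p with linked⇒Link T c N p
  ... | r , r≤N , rung , rl with r <? M₀
  ... | yes r<M₀ = let l , r≤l , l<L , gap = breaks-before-L c r r<M₀ rung
                   in ⊥-elim (clash (rl l r≤l (<-≤-trans l<L L≤N)) gap)
  ... | no r≮M₀ = Link⇒linked B c N (r , r≤N , T-beyond _ rung M₀≤r , λ l a b →
                    ∧-intro (T-beyond _ (proj₁ (∧-elim (rl l a b))) (≤-trans M₀≤r a))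
                            (T-beyond _ (proj₂ (∧-elim {T (bottom c l)} (rl l a b))) (≤-trans M₀≤r a)))
    where M₀≤r = ≮⇒≥ r≮M₀

  N : ℕ
  N = M₀ ⊔ W_D ⊔ L

  M₀≤N : M₀ ≤ N
  M₀≤N = ≤-trans (m≤m⊔n M₀ W_D) (m≤m⊔n _ L)
  W_D≤N : W_D ≤ N
  W_D≤N = ≤-trans (m≤n⊔m M₀ W_D) (m≤m⊔n _ L)
  L≤N : L ≤ N
  L≤N = m≤n⊔m (M₀ ⊔ W_D) L

  newlyLinked : Fin n → Bool
  newlyLinked c = not (linked T c N) ∧ linked F c N

  j : ℕ
  j = sum (λ c → 𝟙 (newlyLinked c))

  j≤n : j ≤ n
  j≤n = sum-𝟙≤ newlyLinked

  -- since T-links are F-links at N, unlinkedness in T splits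
  unlinked-split : Σunlinked T N ≡ Σunlinked F N + j
  unlinked-split = trans (sum-cong-≗ {n} λ c → split (linked T c N) (linked F c N)
                                          (λ p → linked-mono (⊆⇒≼ B⊆F) c N (linkedT⇒linkedB N L≤N c p)))
                         (∑-distrib-+ (λ c → unlinked F c N) (λ c → 𝟙 (newlyLinked c)))
    where
    split : ∀ t f → (t ≡ true → f ≡ true) → 𝟙 (not t) ≡ 𝟙 (not f) + 𝟙 (not t ∧ f)
    split true true _ = refl
    split true false h with h refl
    ... | ()
    split false true _ = refl
    split false false _ = refl

  D-count : edges D N ≡ k + j
  D-count = +-cancelʳ-≡ (Σunlinked F N) _ _ (begin
    edges D N + Σunlinked F N
      ≡⟨ cong (_+ Σunlinked F N) (sym (sum-cong-≗ {n} (edgesUpTo-below D W_D D-below N W_D≤N))) ⟩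
    ΣedgesUpTo D N + Σunlinked F N
      ≡⟨ balanceAt N ⟩
    ΣedgesUpTo K N + Σunlinked T N
      ≡⟨ cong₂ _+_ (K-count N M₀≤N) unlinked-split ⟩
    k + (Σunlinked F N + j)
      ≡⟨ regroup k _ j ⟩
    k + j + Σunlinked F N ∎)
    where
    open ≡-Reasoning
    regroup : ∀ a b c → a + (b + c) ≡ a + c + b
    regroup = solve-∀

  size-F∖B : HasSize (Diff F B) (k + j)
  size-F∖B = ↔-trans (Diff↔∖ F B) (resize D-count (size-edges D N (λ e p → <-≤-trans (D-below e p) W_D≤N)))

-- Every k + j with j ≤ n is a spectrum value

-- The copies c < j carry both rails and no rung; the others carry the bottom
-- rail and every rung.  This T is a saturated independent set; B removes k
-- bottom edges of copy 0 from it, and F adds to T the rung at 0 of each of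
-- the j two-rail copies.  Then F ∖ B consists of k + j edges.
module Realisation {n' : ℕ} (k j : ℕ) (j≤n : j ≤ suc n') where
  n = suc n'

  twoRails : Fin n → Bool
  twoRails c = toℕ c <ᵇ j

  T F B : Subset (Edge n)
  T (bottom c i) = true
  T (top c i) = twoRails c
  T (middle c i) = not (twoRails c)

  F (bottom c i) = true
  F (top c i) = twoRails c
  F (middle c zero) = true
  F (middle c (suc i)) = not (twoRails c)

  B = T ∖ run 0 k

  B⊆T : B ⊆ T
  B⊆T e p = proj₁ (∧-elim p)

  B⊆F : B ⊆ F
  B⊆F (bottom c i) p = refl
  B⊆F (top c i) p = proj₁ (∧-elim p)
  B⊆F (middle c zero) p = refl
  B⊆F (middle c (suc i)) p = proj₁ (∧-elim p)

  freeT : RectangleFree T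
  freeT c N with twoRails c
  ... | true = ∧-zeroʳ _
  ... | false = ∧-zeroʳ _

  freeF : RectangleFree F
  freeF c N with twoRails c
  ... | true = ∧-zeroʳ _
  ... | false = ∧-zeroʳ _

  uFreeT : UFree T
  uFreeT c r (rung , rl) with twoRails c | rl r ≤-refl
  uFreeT c r (() , rl) | true | _
  ... | false | ()

  satT : ∀ c → Saturated T c
  satT c false N _ = refl
  satT c true N (inj₂ unlinked) with twoRails c in two
  ... | true = refl
  ... | false = ⊥-elim (clash (rung⇒linked T c N (cong not two)) unlinked)

  -- F is a base of the finitarization: any further edge closes a rectangle
  baseF : IsBase (finitarization (Trunc n k)) F
  baseF = rectangleFree⇒finitary k F freeF , maximal
    where
    maximal : ∀ S → finitarization (Trunc n k) S → F ⊆ S → S ⊆ F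
    maximal S finS F⊆S = below
      where
      freeS = finitary⇒rectangleFree k S finS
      rung : ∀ {c} → twoRails c ≡ false → ∀ i → S (middle c i) ≡ true
      rung two zero = F⊆S _ refl
      rung two (suc i) = F⊆S _ (cong not two)
      below : S ⊆ F
      below (bottom c i) p = refl
      below (top c i) p with twoRails c in two
      ... | true = refl
      ... | false = ⊥-elim (clash (∧-intro (rung⇒linked S c i (rung two i))
                      (∧-intro (∧-intro (F⊆S (bottom c i) refl) p) (rung two (suc i)))) (freeS c i))
      below (middle c zero) p = refl
      below (middle c (suc i)) p with twoRails c in two
      ... | false = refl
      ... | true = ⊥-elim (clash (∧-intro (Link⇒linked S c i link) (∧-intro (railsS i) p)) (freeS c i))
        where
        railsS : ∀ l → rails S c l ≡ true
        railsS l = ∧-intro (F⊆S (bottom c l) refl) (F⊆S (top c l) two)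
        link : Link S c i
        link = 0 , z≤n , F⊆S (middle c 0) refl , λ l _ _ → railsS l

  indT : AC-Independent n T
  indT = independent⇐ T (freeT , uFreeT)

  T∖B≡run : ∀ e → (T ∖ B) e ≡ run 0 k e
  T∖B≡run (bottom c i) = not-involutive _
  T∖B≡run (top c i) with twoRails c
  ... | true = refl
  ... | false = refl
  T∖B≡run (middle c i) with twoRails c
  ... | true = refl
  ... | false = refl

  size-T∖B : HasSize (Diff T B) k
  size-T∖B = ↔-trans (Diff↔∖ T B) (↔-trans (Elems-cong _ _ T∖B≡run) (size-run 0 k))

  -- B is a base of M_n[k]: a larger S with a witness T' ⊇ S, |T' ∖ S| = k,
  -- would have more edges up to a far position N than T allows
  module Maximal (S T' : Subset (Edge n)) (indT' : AC-Independent n T') (S⊆T' : S ⊆ T')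
                 (size-T'∖S : HasSize (Diff T' S) k) (B⊆S : B ⊆ S)
                 (e : Edge n) (e∈S : S e ≡ true) (e∉B : B e ≡ false) where
    finite-T'∖S = finite⇒below (T' ∖ S) (k , ↔-trans (↔-sym (Diff↔∖ T' S)) size-T'∖S)
    W = proj₁ finite-T'∖S

    N : ℕ
    N = W ⊔ k ⊔ suc (pos e)

    W≤N : W ≤ N
    W≤N = ≤-trans (m≤m⊔n W k) (m≤m⊔n _ _)
    k≤N : k ≤ N
    k≤N = ≤-trans (m≤n⊔m W k) (m≤m⊔n _ _)
    e<N : suc (pos e) ≤ N
    e<N = m≤n⊔m (W ⊔ k) (suc (pos e))

    freeT' = independent⇒ T' indT'

    B⊆T' : B ⊆ T'
    B⊆T' x p = S⊆T' x (B⊆S x p)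

    B-rails : ∀ c → twoRails c ≡ true → ∀ l → k ≤ l → rails B c l ≡ true
    B-rails c two l k≤l =
      ∧-intro (cong not (run-beyond 0 k (bottom c l) k≤l)) (trans (∧-identityʳ (twoRails c)) two)

    -- a link of T' at N is one of T: in a two-rail copy it would start an
    -- infinite U of T', since B ⊆ T' has both rails from N on
    linked-into-T : ∀ c → linked T' c N ≡ true → linked T c N ≡ true
    linked-into-T c p with twoRails c in two
    ... | false = rung⇒linked T c N (cong not two)
    ... | true with linked⇒Link T' c N p
    ... | r , r≤N , rung , rl = ⊥-elim (proj₂ freeT' c r (rung , allRails))
      where
      allRails : ∀ l → r ≤ l → rails T' c l ≡ true
      allRails l r≤l with l <? N
      ... | yes l<N = rl l r≤l l<N
      ... | no l≮N = rails≼ (⊆⇒≼ B⊆T') c l (B-rails c two l (≤-trans k≤N (≮⇒≥ l≮N)))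

    upper : ΣedgesUpTo T' N ≤ ΣedgesUpTo B N + k
    upper = begin
      ΣedgesUpTo T' N                    ≤⟨ sum-mono compare ⟩
      ΣedgesUpTo T N                     ≡⟨ ΣedgesUpTo-∖ B T B⊆T N ⟩
      ΣedgesUpTo B N + ΣedgesUpTo (T ∖ B) N ≡⟨ cong (ΣedgesUpTo B N +_) T∖B-count ⟩
      ΣedgesUpTo B N + k                 ∎
      where
      open ≤-Reasoning
      compare : ∀ c → edgesUpTo T' c N ≤ edgesUpTo T c N
      compare c = edgesUpTo-compare T' T c N (proj₁ freeT') freeT (satT c) (linked-into-T c)
      T∖B-below : Below (T ∖ B) k
      T∖B-below x p = proj₂ (run-range 0 k x (trans (sym (T∖B≡run x)) p))
      T∖B-count : ΣedgesUpTo (T ∖ B) N ≡ k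
      T∖B-count = trans (sum-cong-≗ {n} (edgesUpTo-below (T ∖ B) k T∖B-below N k≤N))
        (size-unique (size-edges (T ∖ B) N (λ x p → <-≤-trans (T∖B-below x p) k≤N))
                     (↔-trans (↔-sym (Diff↔∖ T B)) size-T∖B))

    three-parts : ΣedgesUpTo T' N ≡ ΣedgesUpTo B N + ΣedgesUpTo (S ∖ B) N + ΣedgesUpTo (T' ∖ S) N
    three-parts = trans (ΣedgesUpTo-∖ S T' S⊆T' N) (cong (_+ ΣedgesUpTo (T' ∖ S) N) (ΣedgesUpTo-∖ B S B⊆S N))

    lower : suc (ΣedgesUpTo B N + k) ≤ ΣedgesUpTo T' N
    lower = begin
      suc (ΣedgesUpTo B N + k)                                       ≡⟨ sym (+-suc (ΣedgesUpTo B N) k) ⟩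
      ΣedgesUpTo B N + (1 + k)                                       ≤⟨ +-monoʳ-≤ (ΣedgesUpTo B N) (+-mono-≤ new extra) ⟩
      ΣedgesUpTo B N + (ΣedgesUpTo (S ∖ B) N + ΣedgesUpTo (T' ∖ S) N) ≡⟨ sym (+-assoc (ΣedgesUpTo B N) _ _) ⟩
      ΣedgesUpTo B N + ΣedgesUpTo (S ∖ B) N + ΣedgesUpTo (T' ∖ S) N   ≡⟨ sym three-parts ⟩
      ΣedgesUpTo T' N                                                ∎
      where
      open ≤-Reasoning
      new : 1 ≤ ΣedgesUpTo (S ∖ B) N
      new = ≤-trans (s≤s z≤n) (≤-trans (edges-point (S ∖ B) e (cong₂ (λ x y → x ∧ not y) e∈S e∉B))
              (≤-trans (edges-mono (S ∖ B) e<N) (edges≤ΣedgesUpTo (S ∖ B) N)))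
      extra : k ≤ ΣedgesUpTo (T' ∖ S) N
      extra = subst (_≤ ΣedgesUpTo (T' ∖ S) N)
        (size-unique (size-edges (T' ∖ S) N (λ x p → <-≤-trans (proj₂ finite-T'∖S x p) W≤N))
                     (↔-trans (↔-sym (Diff↔∖ T' S)) size-T'∖S))
        (edges≤ΣedgesUpTo (T' ∖ S) N)

  baseB : IsBase (Trunc n k) B
  baseB = (AC-Independent-anti B⊆T indT , T , indT , B⊆T , size-T∖B) , maximal
    where
    maximal : ∀ S → Trunc n k S → B ⊆ S → S ⊆ B
    maximal S (_ , T' , indT' , S⊆T' , size) B⊆S e e∈S with B e in e∈B
    ... | true = refl
    ... | false = ⊥-elim (<-irrefl refl (≤-trans lower upper))
      where open Maximal S T' indT' S⊆T' size B⊆S e e∈S e∈B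

  -- F ∖ B: the run removed from copy 0 and the added rungs
  G : Subset (Edge n)
  G (bottom c i) = run 0 k (bottom c i)
  G (top _ _) = false
  G (middle c zero) = twoRails c
  G (middle c (suc _)) = false

  F∖B≡G : ∀ e → (F ∖ B) e ≡ G e
  F∖B≡G (bottom c i) = not-involutive _
  F∖B≡G (top c i) with twoRails c
  ... | true = refl
  ... | false = refl
  F∖B≡G (middle c zero) with twoRails c
  ... | true = refl
  ... | false = refl
  F∖B≡G (middle c (suc i)) with twoRails c
  ... | true = refl
  ... | false = refl

  G↔ : Elems G ↔ (Elems (run {n'} 0 k) ⊎ Σ (Fin n) (λ c → twoRails c ≡ true))
  G↔ = mk↔ₛ′ to back
    (λ { (inj₁ (bottom c i , p)) → refl ; (inj₂ _) → refl })
    (λ { (bottom c i , p) → refl ; (middle c zero , p) → refl })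
    where
    to : Elems G → (Elems (run {n'} 0 k) ⊎ Σ (Fin n) (λ c → twoRails c ≡ true))
    to (bottom c i , p) = inj₁ (bottom c i , p)
    to (middle c zero , p) = inj₂ (c , p)
    back : (Elems (run {n'} 0 k) ⊎ Σ (Fin n) (λ c → twoRails c ≡ true)) → Elems G
    back (inj₁ (bottom c i , p)) = bottom c i , p
    back (inj₂ (c , p)) = middle c zero , p

  size-F∖B : HasSize (Diff F B) (k + j)
  size-F∖B = ↔-trans (Diff↔∖ F B) (↔-trans (Elems-cong _ _ F∖B≡G) (↔-trans G↔
    (resize (cong (k +_) (sum-below j j≤n))
            (size-+ (size-run 0 k) (size-Fin _ (λ c → 𝟙 (twoRails c)) (λ c → size-bool _))))))

proposition3p3p2 : ExcludedMiddle 0ℓ → (n k : ℕ) → 1 ≤ n → (c : Card) →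
    InSpec (truncate (AC-Independent n) k) c ⇔ (∃ λ j → (j ≤ n) × (c ≡ fin (k + j)))
proposition3p3p2 LEM (suc n') k (s≤s z≤n) c = mk⇔ spectrum⊆ spectrum⊇
  where
  spectrum⊆ : InSpec (Trunc (suc n') k) c → ∃ λ j → (j ≤ suc n') × (c ≡ fin (k + j))
  spectrum⊆ (F , B , baseF , baseB , B⊆F , card) = j , j≤n , cardIs-fin c card size-F∖B
    where open UpperBound LEM k F B baseF baseB B⊆F

  spectrum⊇ : (∃ λ j → (j ≤ suc n') × (c ≡ fin (k + j))) → InSpec (Trunc (suc n') k) c
  spectrum⊇ (j , j≤n , refl) = F , B , baseF , baseB , B⊆F , size-F∖B
    where open Realisation k j j≤n
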